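{- Let $n\geq 1$, $m\geq 2$, and $s,t\geq 0$ be integers with $s+t\leq m$, and let $S_{s,t}(n,m)$ be the decorated Sierpinski graph. Then for every integer $\ell$ with $0\leq\ell\leq m^n$, \[ \min\{|\Theta_{s,t}(S)| : S\subseteq\{0,\dots,m-1\}^n,\ |S|=\ell\}=|\Theta_{s,t}(Lex^{ -1}(n,m;\ell))|. \]
   Context: For integers $n\geq 1$, $m\geq 2$, the Sierpinski graph $S(n,m)$ has vertex set $\{0,1,\dots,m-1\}^n$; distinct $u=(u_1,\dots,u_n)$, $v=(v_1,\dots,v_n)$ are adjacent iff there is $h\in\{1,\dots,n\}$ with $u_i=v_i$ for $i<h$, $u_h\neq v_h$, and $u_j=v_h$, $v_j=u_h$ for all $j>h$. The vertices $i^n=(i,\dots,i)$ are the corner vertices. Given $s,t\geq0$ with $s+t\leq m$, let $I=\{0,\dots,s-1\}$, $J=\{s,\dots,s+t-1\}$, $K=\{s+t,\dots,m-1\}$. The decorated graph $S_{s,t}(n,m)$ is $S(n,m)$ together with new "exterior" vertices $v_i$ for $i\in I\cup K$ and exterior edges $\{v_i,i^n\}$ for $i\in I\cup K$ (no exterior edges at $j^n$ for $j\in J$). For $S\subseteq\{0,\dots,m-1\}^n$, $\Theta_{s,t}(S)$ is the set of edges of $S_{s,t}(n,m)$ with exactly one endpoint in $S\cup\{v_i: i\in I\}$ (so $v_i$ counts as a member of $S$ if $i\in I$ and as a member of the complement if $i\in K$, while $|S|$ counts only vertices of $\{0,\dots,m-1\}^n$). Lexicographic order: $Lex(v)=1+\sum_{i=1}^n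 v_i m^{n-i}$, and $Lex^{ -1}(n,m;\ell)=\{v\in\{0,\dots,m-1\}^n: Lex(v)\leq\ell\}$. -}

module Defs where

open import Data.Nat using (ℕ; zero; suc; _+_; _*_; _^_; _<ᵇ_; _≤ᵇ_)
open import Data.Bool using (Bool; true; false; _∧_; _∨_; not; if_then_else_)
open import Data.Fin using (Fin; toℕ; _≟_)
open import Data.Vec using (Vec; []; _∷_; replicate)
open import Data.List using (List; []; _∷_; map; length; filterᵇ; cartesianProduct; allFin; concatMap)
open import Data.Product using (_×_; _,_)
open import Relation.Nullary.Decidable using (⌊_⌋)

Vertex : ℕ → ℕ → Set
Vertex n m = Vec (Fin m) n

allVertices : (n m : ℕ) → List (Vertex n m)
allVertices zero    m = [] ∷ []
allVertices (suc n) m = concatMap (λ a → map (a ∷_) (allVertices n m)) (allFin m)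

VSubset : ℕ → ℕ → Set
VSubset n m = Vertex n m → Bool

card : {n m : ℕ} → VSubset n m → ℕ
card {n} {m} S = length (filterᵇ S (allVertices n m))

_==_ : {m : ℕ} → Fin m → Fin m → Bool
a == b = ⌊ a ≟ b ⌋

allEq : {n m : ℕ} → Fin m → Vertex n m → Bool
allEq a []      = true
allEq a (x ∷ v) = (x == a) ∧ allEq a v

-- Adjacency in S(n,m), the paper's definition unrolled over the first position:
-- either u_1 = v_1 and the tails are adjacent (h > 1), or u_1 ≠ v_1 and
-- u_j = v_1, v_j = u_1 for all j > 1 (h = 1).
adj : {n m : ℕ} → Vertex n m → Vertex n m → Bool
adj []      []      = false
adj (a ∷ u) (b ∷ v) = if a == b then adj u v
                      else (allEq b u ∧ allEq a v)

corner : (n : ℕ) {m : ℕ} → Fin m → Vertex n m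
corner n i = replicate n i

-- |Θ_{s,t}(S)|:
--   inner edges {u,v} of S(n,m) with u ∈ S, v ∉ S (each such edge counted once
--   via its orientation from S to the complement), plus
--   exterior edges {v_i, i^n}: for i ∈ I (i < s), v_i ∈ S so the edge counts iff i^n ∉ S;
--   for i ∈ K (s+t ≤ i), v_i ∉ S so the edge counts iff i^n ∈ S; no edges for i ∈ J.
innerCut : {n m : ℕ} → VSubset n m → ℕ
innerCut {n} {m} S =
  length (filterᵇ (λ { (u , v) → S u ∧ (not (S v) ∧ adj u v) })
                  (cartesianProduct (allVertices n m) (allVertices n m)))

exteriorCut : (s t : ℕ) {n m : ℕ} → VSubset n m → ℕ
exteriorCut s t {n} {m} S =
  length (filterᵇ (λ i → ((toℕ i <ᵇ s) ∧ not (S (corner n i)))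
                       ∨ (((s + t) ≤ᵇ toℕ i) ∧ S (corner n i)))
                  (allFin m))

Θ-size : (s t : ℕ) {n m : ℕ} → VSubset n m → ℕ
Θ-size s t S = innerCut S + exteriorCut s t S

lexVal : {n m : ℕ} → Vertex n m → ℕ
lexVal []              = 0
lexVal {suc n} {m} (a ∷ v) = toℕ a * m ^ n + lexVal v

Lex : {n m : ℕ} → Vertex n m → ℕ
Lex v = suc (lexVal v)

Lex⁻¹ : (n m ℓ : ℕ) → VSubset n m
Lex⁻¹ n m ℓ v = Lex v ≤ᵇ ℓ

-- S(n+1, m) is m copies a·S(n, m) of S(n, m); distinct copies a, b are joined by the single
-- bridge {a bⁿ, b aⁿ}, whose endpoints are corners of the copies. Write ℓ = q mⁿ + r (q full
-- copies, one copy holding r vertices) and define φ n ℓ K by recursion on these digits: it is a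
-- lower bound for innerCut S + ∣ K − #corners(S) ∣ over ∣S∣ = ℓ that Lex⁻¹ ℓ attains.
-- Two inequalities carry the proof:
--   φ n ∣S∣ #corners(S) ≤ innerCut S  (φ≤innerᵛ), and
--   φ n ℓ c + ∣ K − c ∣ ≤ φ n ℓ K, where c = #corners(Lex⁻¹ ℓ)  (φ-V).
-- The first is proved by induction on n: moving vertices between copies (exchange, normalise)
-- makes all copies but one empty or full without increasing the bound, and then the bridges
-- forced by the corner pattern pay for the top-level term (BridgeCount). The second compares the
-- exterior edges, which only see corners, with those of an arbitrary S.

module Submission where

open import Defs
open import Data.Nat using (ℕ; _+_; _^_; _≤_)
open import Data.Product using (_×_)
open import Relation.Binary.PropositionalEquality using (_≡_)

open import Data.Bool using (Bool; true; false; T; if_then_else_; not; _∧_; _∨_; _xor_)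
open import Data.Bool.Properties using (∧-comm; ∧-zeroʳ; ∧-identityʳ; ∧-inverseʳ; T-∧)
open import Data.Empty using (⊥; ⊥-elim)
open import Data.Fin using (Fin; zero; suc; toℕ; _≟_)
open import Data.Fin.Properties using (toℕ<n)
open import Data.List using (List; []; _∷_; map; length; filterᵇ; concatMap; tabulate; allFin; cartesianProduct)
open import Data.List.Properties using (map-++; map-∘; map-cong; map-tabulate)
open import Data.Nat using (zero; suc; _*_; _∸_; _<_; z≤n; s≤s; _<ᵇ_; _≤ᵇ_; _≡ᵇ_; ∣_-_∣; _≤?_; _<?_; >-nonZero)
open import Data.Nat.ListAction using () renaming (sum to sumˡ)
open import Data.Nat.ListAction.Properties using () renaming (sum-++ to sumˡ-++)
open import Data.Nat.Properties hiding (_≟_)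
open import Data.Nat.Tactic.RingSolver using (solve-∀)
open import Data.Product using (Σ; _,_; proj₁; proj₂)
open import Data.Sum using (_⊎_; inj₁; inj₂)
import Data.Sum
open import Data.Unit using (tt)
open import Data.Vec using ([]; _∷_; replicate)
open import Function using (_∘_; id)
open import Function.Bundles using (Equivalence)
open import Relation.Binary using (tri<; tri≈; tri>)
open import Relation.Binary.PropositionalEquality
open import Relation.Nullary using (yes; no; ¬_)
open import Algebra.Properties.CommutativeSemigroup +-commutativeSemigroup
  using (interchange; x∙yz≈xz∙y; x∙yz≈yx∙z; x∙yz≈y∙xz; xy∙z≈xz∙y)
open import Algebra.Properties.Semiring.Sum +-*-semiring
  using (sum; sum-syntax; sum-cong-≗; sum-replicate-zero; ∑-distrib-+; ∑-comm; *-distribˡ-sum)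

⟦_⟧ : Bool → ℕ
⟦ true ⟧ = 1
⟦ false ⟧ = 0

⟦⟧≤1 : ∀ b → ⟦ b ⟧ ≤ 1
⟦⟧≤1 true = s≤s z≤n
⟦⟧≤1 false = z≤n

BoolFormula : ℕ → Set
BoolFormula zero = Bool
BoolFormula (suc k) = Bool → BoolFormula k

Valid : ∀ k → BoolFormula k → Set
Valid zero b = T b
Valid (suc k) f = ∀ b → Valid k (f b)

check : ∀ k → BoolFormula k → Bool
check zero b = b
check (suc k) f = check k (f true) ∧ check k (f false)

check-sound : ∀ k f → T (check k f) → Valid k f
check-sound zero b h = h
check-sound (suc k) f h true = check-sound k (f true) (proj₁ (Equivalence.to (T-∧ {check k (f true)}) h))
check-sound (suc k) f h false = check-sound k (f false) (proj₂ (Equivalence.to (T-∧ {check k (f true)}) h))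

T-∨-elim : ∀ {a b} → ¬ T a → T (a ∨ b) → T b
T-∨-elim {true} ¬a _ = ⊥-elim (¬a tt)
T-∨-elim {false} _ h = h

∑-mono-≤ : ∀ j {f g : Fin j → ℕ} → (∀ i → f i ≤ g i) → sum f ≤ sum g
∑-mono-≤ zero e = z≤n
∑-mono-≤ (suc j) e = +-mono-≤ (e zero) (∑-mono-≤ j (λ i → e (suc i)))

∑-const : ∀ j c → ∑[ _ < j ] c ≡ j * c
∑-const zero c = refl
∑-const (suc j) c = cong (c +_) (∑-const j c)

∑-bound : ∀ j (f : Fin j → ℕ) c → (∀ i → f i ≤ c) → sum f ≤ j * c
∑-bound j f c h = ≤-trans (∑-mono-≤ j h) (≤-reflexive (∑-const j c))

∑⟦⟧≤ : ∀ j (f : Fin j → Bool) → ∑[ i < j ] ⟦ f i ⟧ ≤ j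
∑⟦⟧≤ j f = ≤-trans (∑-bound j _ 1 (λ i → ⟦⟧≤1 (f i))) (≤-reflexive (*-identityʳ j))

∣∑-∑∣≤∑∣-∣ : ∀ j (f g : Fin j → ℕ) → ∣ sum f - sum g ∣ ≤ ∑[ i < j ] ∣ f i - g i ∣
∣∑-∑∣≤∑∣-∣ zero f g = z≤n
∣∑-∑∣≤∑∣-∣ (suc j) f g = ≤-trans (∣a+b-c+d∣ (f zero) (sum (f ∘ suc)) (g zero) (sum (g ∘ suc)))
                               (+-monoʳ-≤ ∣ f zero - g zero ∣ (∣∑-∑∣≤∑∣-∣ j (λ i → f (suc i)) (λ i → g (suc i))))
  where
  ∣a+b-c+d∣ : ∀ a b c d → ∣ a + b - (c + d) ∣ ≤ ∣ a - c ∣ + ∣ b - d ∣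
  ∣a+b-c+d∣ a b c d = ≤-trans (∣-∣-triangle (a + b) (c + b) (c + d))
     (+-mono-≤ (≤-reflexive (trans (cong₂ ∣_-_∣ (+-comm a b) (+-comm c b)) (∣m+n-m+o∣≡∣n-o∣ b a c)))
               (≤-reflexive (∣m+n-m+o∣≡∣n-o∣ c b d)))

-- Unlike Defs._==_, eqb computes by recursion on both arguments, so sums over Fin reduce.
eqb : ∀ {j} → Fin j → Fin j → Bool
eqb zero zero = true
eqb zero (suc _) = false
eqb (suc _) zero = false
eqb (suc a) (suc b) = eqb a b

eqb-refl : ∀ {j} (a : Fin j) → eqb a a ≡ true
eqb-refl zero = refl
eqb-refl (suc a) = eqb-refl a

eqb-sym : ∀ {j} (a b : Fin j) → eqb a b ≡ eqb b a
eqb-sym zero zero = refl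
eqb-sym zero (suc b) = refl
eqb-sym (suc a) zero = refl
eqb-sym (suc a) (suc b) = eqb-sym a b

eqb-true : ∀ {j} (a b : Fin j) → eqb a b ≡ true → a ≡ b
eqb-true zero zero e = refl
eqb-true (suc a) (suc b) e = cong suc (eqb-true a b e)

∑-pick : ∀ j (p : Fin j) (g : Fin j → ℕ) → ∑[ i < j ] (if eqb i p then g i else 0) ≡ g p
∑-pick (suc j) zero g = trans (cong (g zero +_) (sum-replicate-zero j)) (+-identityʳ _)
∑-pick (suc j) (suc p) g = ∑-pick j p (λ i → g (suc i))

∑-split : ∀ j (p : Fin j) (g : Fin j → ℕ) →
  sum g ≡ g p + ∑[ i < j ] (if eqb i p then 0 else g i)
∑-split (suc j) zero g = refl
∑-split (suc j) (suc p) g =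
  trans (cong (g zero +_) (∑-split j p (g ∘ suc))) (x∙yz≈y∙xz (g zero) (g (suc p)) _)

∑-count< : ∀ j c → c ≤ j → ∑[ i < j ] ⟦ toℕ i <ᵇ c ⟧ ≡ c
∑-count< zero .zero z≤n = refl
∑-count< (suc j) zero _ = sum-replicate-zero (suc j)
∑-count< (suc j) (suc c) (s≤s h) = cong suc (∑-count< j c h)

⟦not⟧+⟦⟧ : ∀ b → ⟦ not b ⟧ + ⟦ b ⟧ ≡ 1
⟦not⟧+⟦⟧ true = refl
⟦not⟧+⟦⟧ false = refl

∑⟦not⟧+∑⟦⟧ : ∀ j (f : Fin j → Bool) → ∑[ i < j ] ⟦ not (f i) ⟧ + ∑[ i < j ] ⟦ f i ⟧ ≡ j
∑⟦not⟧+∑⟦⟧ j f = trans (sym (∑-distrib-+ (λ i → ⟦ not (f i) ⟧) (λ i → ⟦ f i ⟧))) (trans (sum-cong-≗ {j} (λ i → ⟦not⟧+⟦⟧ (f i))) (trans (∑-const j 1) (*-identityʳ j)))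

∑-update : ∀ j (p : Fin j) (X G : Fin j → ℕ) →
  ∑[ i < j ] (if eqb i p then X i else G i) ≡ X p + ∑[ i < j ] (if eqb i p then 0 else G i)
∑-update j p X G = trans (∑-split j p _) (cong₂ _+_ (cong (λ e → if e then X p else G p) (eqb-refl p)) (sum-cong-≗ pointwise))
  where
  pointwise : ∀ i → (if eqb i p then 0 else (if eqb i p then X i else G i)) ≡ (if eqb i p then 0 else G i)
  pointwise i with eqb i p
  ... | true = refl
  ... | false = refl

cons-update : ∀ {j} → ℕ → Fin j → ℕ → (Fin j → ℕ) → Fin (suc j) → ℕ
cons-update a p b ℓ zero = a
cons-update a p b ℓ (suc i) = if eqb i p then b else ℓ i

∑-cons-pick : ∀ j (p : Fin j) (F : Fin (suc j) → ℕ → ℕ) a (ℓ : Fin j → ℕ) →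
  F zero a + ∑[ i < j ] F (suc i) (ℓ i) ≡ F zero a + F (suc p) (ℓ p) + ∑[ i < j ] (if eqb i p then 0 else F (suc i) (ℓ i))
∑-cons-pick j p F a ℓ =
  trans (cong (F zero a +_) (∑-split j p (λ i → F (suc i) (ℓ i)))) (sym (+-assoc (F zero a) _ _))

∑-cons-update : ∀ j (p : Fin j) (F : Fin (suc j) → ℕ → ℕ) a b (ℓ : Fin j → ℕ) →
  ∑[ i < suc j ] F i (cons-update a p b ℓ i)
    ≡ F zero a + F (suc p) b + ∑[ i < j ] (if eqb i p then 0 else F (suc i) (ℓ i))
∑-cons-update j p F a b ℓ = trans (cong (F zero a +_) (trans (sum-cong-≗ F-if) (∑-update j p (λ i → F (suc i) b) (λ i → F (suc i) (ℓ i)))))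
  (sym (+-assoc (F zero a) _ _))
  where
  F-if : ∀ i → F (suc i) (if eqb i p then b else ℓ i) ≡ (if eqb i p then F (suc i) b else F (suc i) (ℓ i))
  F-if i with eqb i p
  ... | true = refl
  ... | false = refl

∑-if0 : ∀ j (e : Bool) (g : Fin j → ℕ) → ∑[ b < j ] (if e then 0 else g b) ≡ (if e then 0 else sum g)
∑-if0 j true g = sum-replicate-zero j
∑-if0 j false g = refl

∑∑-symmetrize : ∀ j (f : Fin j → Fin j → ℕ) →
  ∑[ a < j ] ∑[ b < j ] (f a b + f b a) ≡ 2 * ∑[ a < j ] ∑[ b < j ] f a b
∑∑-symmetrize j f = begin
  ∑[ a < j ] ∑[ b < j ] (f a b + f b a)
    ≡⟨ sum-cong-≗ (λ a → ∑-distrib-+ (f a) (λ b → f b a)) ⟩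
  ∑[ a < j ] (sum (f a) + ∑[ b < j ] f b a)
    ≡⟨ ∑-distrib-+ (λ a → sum (f a)) (λ a → ∑[ b < j ] f b a) ⟩
  S + ∑[ a < j ] ∑[ b < j ] f b a
    ≡⟨ cong (S +_) (∑-comm (λ a b → f b a)) ⟩
  S + S
    ≡⟨ cong (S +_) (sym (+-identityʳ S)) ⟩
  2 * S ∎
  where
  open ≡-Reasoning
  S = ∑[ a < j ] ∑[ b < j ] f a b

∑-count-between : ∀ j lo hi → hi ≤ j → ∑[ i < j ] ⟦ not (toℕ i <ᵇ lo) ∧ (toℕ i <ᵇ hi) ⟧ ≡ hi ∸ lo
∑-count-between zero lo .zero z≤n = sym (0∸n≡0 lo)
∑-count-between (suc j) zero hi h = ∑-count< (suc j) hi h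
∑-count-between (suc j) (suc lo) zero h = trans (sum-cong-≗ {j} (λ i → cong ⟦_⟧ (∧-zeroʳ (not (toℕ i <ᵇ lo))))) (sum-replicate-zero j)
∑-count-between (suc j) (suc lo) (suc hi) (s≤s h) = ∑-count-between j lo hi h

∑-count≡ : ∀ j q → q < j → ∑[ i < j ] ⟦ toℕ i ≡ᵇ q ⟧ ≡ 1
∑-count≡ (suc j) zero h = cong suc (sum-replicate-zero j)
∑-count≡ (suc j) (suc q) (s≤s h) = ∑-count≡ j q h

∑-count> : ∀ j q → q < j → ∑[ i < j ] ⟦ q <ᵇ toℕ i ⟧ ≡ j ∸ suc q
∑-count> (suc j) zero h = trans (∑-const j 1) (*-identityʳ j)
∑-count> (suc j) (suc q) (s≤s h) = ∑-count> j q h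

<ᵇ-true : ∀ {a b} → a < b → (a <ᵇ b) ≡ true
<ᵇ-true {a} {b} h with a <ᵇ b in e
... | true = refl
... | false = ⊥-elim (subst T e (<⇒<ᵇ h))

<ᵇ-false : ∀ {a b} → b ≤ a → (a <ᵇ b) ≡ false
<ᵇ-false {a} {b} h with a <ᵇ b in e
... | false = refl
... | true = ⊥-elim (<⇒≱ (<ᵇ⇒< a b (subst T (sym e) tt)) h)

≤ᵇ-true : ∀ {a b} → a ≤ b → (a ≤ᵇ b) ≡ true
≤ᵇ-true {a} {b} h with a ≤ᵇ b in e
... | true = refl
... | false = ⊥-elim (subst T e (≤⇒≤ᵇ h))

≤ᵇ-false : ∀ {a b} → b < a → (a ≤ᵇ b) ≡ false
≤ᵇ-false {a} {b} h with a ≤ᵇ b in e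
... | false = refl
... | true = ⊥-elim (<⇒≱ h (≤ᵇ⇒≤ a b (subst T (sym e) tt)))

≡ᵇ-refl : ∀ a → (a ≡ᵇ a) ≡ true
≡ᵇ-refl zero = refl
≡ᵇ-refl (suc a) = ≡ᵇ-refl a

≡ᵇ-false : ∀ {a b} → a ≢ b → (a ≡ᵇ b) ≡ false
≡ᵇ-false {zero} {zero} ne = ⊥-elim (ne refl)
≡ᵇ-false {zero} {suc b} ne = refl
≡ᵇ-false {suc a} {zero} ne = refl
≡ᵇ-false {suc a} {suc b} ne = ≡ᵇ-false {a} {b} (λ e → ne (cong suc e))

∣m+n-m∣≡n : ∀ m n → ∣ m + n - m ∣ ≡ n
∣m+n-m∣≡n m n = trans (∣-∣-comm (m + n) m) (∣m-m+n∣≡n m n)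

∣n-suc-n∣≡1 : ∀ n → ∣ n - suc n ∣ ≡ 1
∣n-suc-n∣≡1 zero = refl
∣n-suc-n∣≡1 (suc n) = ∣n-suc-n∣≡1 n

∣suc-n-n∣≡1 : ∀ n → ∣ suc n - n ∣ ≡ 1
∣suc-n-n∣≡1 n = trans (∣-∣-comm (suc n) n) (∣n-suc-n∣≡1 n)

m≡n+o⇒m∸n≡o : ∀ m n o → m ≡ n + o → m ∸ n ≡ o
m≡n+o⇒m∸n≡o .(n + o) n o refl = m+n∸m≡n n o

∸-suc : ∀ {m n} → n < m → m ∸ n ≡ suc (m ∸ suc n)
∸-suc {suc m} (s≤s n≤m) = +-∸-assoc 1 n≤m

∸-chain : ∀ {a b c} → a ≤ b → b ≤ c → (b ∸ a) + (c ∸ b) ≡ c ∸ a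
∸-chain {a} ab bc with m≤n⇒∃[o]m+o≡n ab | m≤n⇒∃[o]m+o≡n bc
... | d , refl | e , refl rewrite m+n∸m≡n a d | m+n∸m≡n (a + d) e | +-assoc a d e | m+n∸m≡n a (d + e) = refl

+∸≤ : ∀ a b c → (a + b) ∸ c ≤ (a ∸ c) + b
+∸≤ a b zero = ≤-refl
+∸≤ zero b (suc c) = m∸n≤m b (suc c)
+∸≤ (suc a) b (suc c) = +∸≤ a b c

∸≤∣-∣+∸ : ∀ a b c → a ∸ b ≤ ∣ c - b ∣ + (a ∸ c)
∸≤∣-∣+∸ a b c =
  ≤-trans (∸-monoˡ-≤ b (m≤n+m∸n a c)) (≤-trans (+∸≤ c (a ∸ c) b) (+-monoˡ-≤ (a ∸ c) (m∸n≤∣m-n∣ c b)))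

∣∸-∸∣ : ∀ m a b → a ≤ m → b ≤ m → ∣ m ∸ a - m ∸ b ∣ ≡ ∣ a - b ∣
∣∸-∸∣ m a b a≤m b≤m with ≤-<-connex b a
... | inj₁ b≤a with m≤n⇒∃[o]m+o≡n b≤a | m≤n⇒∃[o]m+o≡n a≤m
...   | d , refl | x , refl rewrite +-assoc b d x | m+n∸m≡n b (d + x) | [m+n]∸[m+o]≡n∸o b (d + x) d | m+n∸m≡n d x =
        trans (cong (λ z → ∣ x - z ∣) (+-comm d x)) (trans (∣m-m+n∣≡n x d) (sym (∣m+n-m∣≡n b d)))
∣∸-∸∣ m a b a≤m b≤m | inj₂ a<b with m≤n⇒∃[o]m+o≡n (<⇒≤ a<b) | m≤n⇒∃[o]m+o≡n b≤m
...   | d , refl | x , refl rewrite +-assoc a d x | m+n∸m≡n a (d + x) | [m+n]∸[m+o]≡n∸o a (d + x) d | m+n∸m≡n d x =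
        trans (cong (λ z → ∣ z - x ∣) (+-comm d x)) (trans (∣m+n-m∣≡n x d) (sym (∣m-m+n∣≡n a d)))

complement-pair : ∀ M x y → x ≤ M → y ≤ M → (M ∸ x) + (M ∸ y) + (x + y) ≡ M + M
complement-pair M x y x≤M y≤M =
  trans (interchange (M ∸ x) (M ∸ y) x y) (cong₂ _+_ (m∸n+n≡m x≤M) (m∸n+n≡m y≤M))

complement-pair-sum : ∀ M x y a b → x ≤ M → y ≤ M → a ≤ M → b ≤ M →
  a + b ≡ (M ∸ x) + (M ∸ y) → (M ∸ a) + (M ∸ b) ≡ x + y
complement-pair-sum M x y a b x≤M y≤M a≤M b≤M e = +-cancelʳ-≡ (a + b) _ _ (begin
  (M ∸ a) + (M ∸ b) + (a + b)  ≡⟨ complement-pair M a b a≤M b≤M ⟩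
  M + M                        ≡⟨ complement-pair M x y x≤M y≤M ⟨
  (M ∸ x) + (M ∸ y) + (x + y)  ≡⟨ +-comm _ (x + y) ⟩
  x + y + ((M ∸ x) + (M ∸ y))  ≡⟨ cong (x + y +_) e ⟨
  x + y + (a + b)              ∎)
  where open ≡-Reasoning

complement-pair-≤ : ∀ M x y → x ≤ M → y ≤ M → M < x + y → (M ∸ x) + (M ∸ y) ≤ M
complement-pair-≤ M x y x≤M y≤M h =
  +-cancelʳ-≤ (x + y) _ M (≤-trans (≤-reflexive (complement-pair M x y x≤M y≤M)) (+-monoʳ-≤ M (<⇒≤ h)))

complement-digits : ∀ m₀ M q r → q ≤ m₀ → r ≤ M → suc m₀ * M ∸ (q * M + r) ≡ (m₀ ∸ q) * M + (M ∸ r)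
complement-digits m₀ M q r q≤m₀ r≤M with m≤n⇒∃[o]m+o≡n q≤m₀ | m≤n⇒∃[o]m+o≡n r≤M
... | d , refl | e , refl = begin
  suc (q + d) * (r + e) ∸ (q * (r + e) + r)               ≡⟨ cong (_∸ (q * (r + e) + r)) (expand q d r e) ⟩
  q * (r + e) + r + (d * (r + e) + e) ∸ (q * (r + e) + r) ≡⟨ m+n∸m≡n (q * (r + e) + r) _ ⟩
  d * (r + e) + e                                         ≡⟨ cong₂ (λ x y → x * (r + e) + y) (m+n∸m≡n q d) (m+n∸m≡n r e) ⟨
  (q + d ∸ q) * (r + e) + (r + e ∸ r)                     ∎
  where
  open ≡-Reasoning
  expand : ∀ q d r e → suc (q + d) * (r + e) ≡ (q * (r + e) + r) + (d * (r + e) + e)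
  expand = solve-∀

sum-regroup : ∀ x y r₁ r₂ a b {α β z} → α ≡ x + r₁ → β ≡ y + r₂ → a + b ≡ r₁ + r₂ → z ≡ y + b →
  x + a + z ≡ α + β
sum-regroup x y r₁ r₂ a b refl refl a+b≡ refl =
  trans (interchange x a y b) (trans (cong ((x + y) +_) a+b≡) (interchange x y r₁ r₂))

m+n≤n⇒m≡0 : ∀ m n → m + n ≤ n → m ≡ 0
m+n≤n⇒m≡0 zero n h = refl
m+n≤n⇒m≡0 (suc m) n h = ⊥-elim (<⇒≱ (s≤s (m≤n+m n m)) h)

digits-overflow : ∀ m q₁ q₂ r M → 0 < M → m ≤ q₁ + q₂ → q₁ * M + r + q₂ * M ≤ m * M →
  (q₁ + q₂ ≡ m) × (r ≡ 0)
digits-overflow m q₁ q₂ r (suc M) _ m≤q h = ≤-antisym q≤m m≤q , r≡0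
  where
  regroup : ∀ q₁ q₂ r M → q₁ * M + r + q₂ * M ≡ r + (q₁ + q₂) * M
  regroup = solve-∀
  bound : r + (q₁ + q₂) * suc M ≤ m * suc M
  bound = ≤-trans (≤-reflexive (sym (regroup q₁ q₂ r (suc M)))) h
  r≡0 : r ≡ 0
  r≡0 = m+n≤n⇒m≡0 r (m * suc M) (≤-trans (+-monoʳ-≤ r (*-monoˡ-≤ (suc M) m≤q)) bound)
  q≤m : q₁ + q₂ ≤ m
  q≤m = *-cancelʳ-≤ (q₁ + q₂) m (suc M) (≤-trans (m≤n+m _ r) bound)

-- s = ∣I∣, t = ∣J∣; eS counts the corners of I outside S and kI, kJ, kK the corners of S in
-- I, J, K. The left side is the exterior cut of a set whose corners are 0, …, c − 1.
exterior-arith : ∀ s t c eS kI kJ kK → eS + kI ≡ s → kJ ≤ t →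
  (s ∸ c) + (c ∸ (s + t)) ≤ (eS + kK) + ∣ kI + kJ + kK - c ∣
exterior-arith .(eS + kI) t c eS kI kJ kK refl kJ≤t with ≤-<-connex c (eS + kI)
... | inj₁ c≤s rewrite m≤n⇒m∸n≡0 (≤-trans c≤s (m≤m+n (eS + kI) t)) | +-identityʳ ((eS + kI) ∸ c) =
  begin
    (eS + kI) ∸ c            ≡⟨ cong (_∸ c) (+-comm eS kI) ⟩
    (kI + eS) ∸ c            ≤⟨ +∸≤ kI eS c ⟩
    (kI ∸ c) + eS            ≤⟨ +-monoˡ-≤ eS (∸-monoˡ-≤ c (≤-trans (m≤m+n kI kJ) (m≤m+n (kI + kJ) kK))) ⟩
    (kI + kJ + kK ∸ c) + eS  ≤⟨ +-monoˡ-≤ eS (m∸n≤∣m-n∣ (kI + kJ + kK) c) ⟩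
    ∣ kI + kJ + kK - c ∣ + eS ≤⟨ +-monoʳ-≤ _ (m≤m+n eS kK) ⟩
    ∣ kI + kJ + kK - c ∣ + (eS + kK) ≡⟨ +-comm _ (eS + kK) ⟩
    eS + kK + ∣ kI + kJ + kK - c ∣ ∎
  where open ≤-Reasoning
... | inj₂ s<c rewrite m≤n⇒m∸n≡0 (<⇒≤ s<c) =
  begin
    c ∸ (eS + kI + t)                ≤⟨ ∸-monoʳ-≤ c (+-mono-≤ (m≤n+m kI eS) kJ≤t) ⟩
    c ∸ (kI + kJ)                    ≤⟨ m≤n+m∸n (c ∸ (kI + kJ)) kK ⟩
    kK + (c ∸ (kI + kJ) ∸ kK)        ≡⟨ cong (kK +_) (∸-+-assoc c (kI + kJ) kK) ⟩
    kK + (c ∸ (kI + kJ + kK))        ≤⟨ +-monoʳ-≤ kK (m∸n≤∣m-n∣ c (kI + kJ + kK)) ⟩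
    kK + ∣ c - (kI + kJ + kK) ∣      ≤⟨ +-monoˡ-≤ _ (m≤n+m kK eS) ⟩
    eS + kK + ∣ c - (kI + kJ + kK) ∣ ≡⟨ cong (eS + kK +_) (∣-∣-comm c _) ⟩
    eS + kK + ∣ kI + kJ + kK - c ∣   ∎
  where open ≤-Reasoning

-- q full copies followed by a copy whose corners 0, …, K − 1 are present have the corners
-- 0, …, κ q K − 1; blockPairs m q counts the bridges from the full copies to the m − 1 − q
-- copies after the partial one.
κ : ℕ → ℕ → ℕ
κ q K = q + ⟦ q <ᵇ K ⟧

blockPairs : ℕ → ℕ → ℕ
blockPairs m q = q * (m ∸ suc q)

ψ : ℕ → ℕ → ℕ → ℕ
ψ m q K = blockPairs m q + ∣ κ q K - K ∣

κ≡q : ∀ q K → K ≤ q → κ q K ≡ q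
κ≡q q K h = trans (cong (λ b → q + ⟦ b ⟧) (<ᵇ-false h)) (+-identityʳ q)

κ≡suc-q : ∀ q K → q < K → κ q K ≡ suc q
κ≡suc-q q K h = trans (cong (λ b → q + ⟦ b ⟧) (<ᵇ-true h)) (+-comm q 1)

q≤κ : ∀ q K → q ≤ κ q K
q≤κ q K = m≤m+n q ⟦ q <ᵇ K ⟧

κ≤m : ∀ m q K → q < m → κ q K ≤ m
κ≤m m q K q<m with ≤-<-connex K q
... | inj₁ h = ≤-trans (≤-reflexive (κ≡q q K h)) (<⇒≤ q<m)
... | inj₂ h = ≤-trans (≤-reflexive (κ≡suc-q q K h)) q<m

κ-idem : ∀ q c → κ q (κ q c) ≡ κ q c
κ-idem q c with ≤-<-connex c q
... | inj₁ h rewrite κ≡q q c h | κ≡q q q ≤-refl = refl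
... | inj₂ h rewrite κ≡suc-q q c h | κ≡suc-q q (suc q) ≤-refl = refl

∣κ-∣-split : ∀ q c → ∣ κ q c - c ∣ ≡ (q ∸ c) + (c ∸ suc q)
∣κ-∣-split q c with ≤-<-connex c q
... | inj₁ h rewrite κ≡q q c h | m≤n⇒m∸n≡0 (m≤n⇒m≤1+n h) = trans (m≤n⇒∣n-m∣≡n∸m h) (sym (+-identityʳ (q ∸ c)))
... | inj₂ h rewrite κ≡suc-q q c h | m≤n⇒m∸n≡0 (<⇒≤ h) = m≤n⇒∣m-n∣≡n∸m h

ψ-zero : ∀ m K → ψ m 0 K + κ 0 K ≡ K
ψ-zero m zero = refl
ψ-zero m (suc K) = +-comm K 1

ψ-last : ∀ m₀ K → K ≤ suc m₀ → ψ (suc m₀) m₀ K + (suc m₀ ∸ κ m₀ K) ≡ suc m₀ ∸ K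
ψ-last m₀ K h with m≤n⇒m<n∨m≡n h
... | inj₂ refl rewrite κ≡suc-q m₀ (suc m₀) ≤-refl | n∸n≡0 m₀ | *-zeroʳ m₀ | ∣n-n∣≡0 m₀ = refl
... | inj₁ (s≤s K≤m₀) rewrite κ≡q m₀ K K≤m₀ | n∸n≡0 m₀ | *-zeroʳ m₀ | m≤n⇒∣n-m∣≡n∸m K≤m₀
  | +-∸-assoc 1 (≤-refl {m₀}) | n∸n≡0 m₀ | +-∸-assoc 1 K≤m₀ = +-comm (m₀ ∸ K) 1

-- The two digit expansions of (q + 1) mⁿ, ending in a full or in an empty block, agree under φ.
ψ-step : ∀ m q K → suc (suc q) ≤ m → K ≤ m → ψ m q K + (m ∸ κ q K) ≡ ψ m (suc q) K + κ (suc q) K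
ψ-step m q K h _ with m≤n⇒∃[o]m+o≡n h
... | e , refl = byCases K q (compare K q)
  where
  compare : ∀ a b → (Σ ℕ λ d → b ≡ a + d) ⊎ (Σ ℕ λ d → a ≡ b + suc d)
  compare zero b = inj₁ (b , refl)
  compare (suc a) zero = inj₂ (a , refl)
  compare (suc a) (suc b) with compare a b
  ... | inj₁ (d , e) = inj₁ (d , cong suc e)
  ... | inj₂ (d , e) = inj₂ (d , cong suc e)

  ∣-∣≡ʳ : ∀ a b c → a ≡ b + c → ∣ a - b ∣ ≡ c
  ∣-∣≡ʳ .(b + c) b c refl = ∣m+n-m∣≡n b c
  ∣-∣≡ˡ : ∀ a b c → a ≡ b + c → ∣ b - a ∣ ≡ c
  ∣-∣≡ˡ .(b + c) b c refl = ∣m-m+n∣≡n b c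

  eq₁ : ∀ K d e → suc (suc (K + d) + e) ≡ suc (K + d) + suc e
  eq₁ = solve-∀
  eq₂ : ∀ K d e → suc (suc (K + d) + e) ≡ K + d + suc (suc e)
  eq₂ = solve-∀
  eq₃ : ∀ q e → suc (suc q) + e ≡ suc q + suc e
  eq₃ = solve-∀
  eq₄ : ∀ q d → suc (suc q) + d ≡ q + suc (suc d)
  eq₄ = solve-∀
  ring₁ : ∀ K d e → (K + d) * suc e + d + suc (suc e) ≡ suc (K + d) * e + suc d + suc (K + d)
  ring₁ = solve-∀
  ring₂ : ∀ q e → q * suc e + 0 + suc e ≡ suc q * e + 0 + suc q
  ring₂ = solve-∀
  ring₃ : ∀ q d e → q * suc e + suc d + suc e ≡ suc q * e + d + suc (suc q)
  ring₃ = solve-∀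

  byCases : ∀ K q → (Σ ℕ λ d → q ≡ K + d) ⊎ (Σ ℕ λ d → K ≡ q + suc d) →
    ψ (suc (suc q) + e) q K + (suc (suc q) + e ∸ κ q K) ≡ ψ (suc (suc q) + e) (suc q) K + κ (suc q) K
  byCases K .(K + d) (inj₁ (d , refl))
    rewrite κ≡q (K + d) K (m≤m+n K d) | κ≡q (suc (K + d)) K (m≤n⇒m≤1+n (m≤m+n K d))
          | ∣m+n-m∣≡n K d | m≡n+o⇒m∸n≡o (suc (suc (K + d) + e)) (suc (K + d)) (suc e) (eq₁ K d e)
          | m≡n+o⇒m∸n≡o (suc (suc (K + d) + e)) (suc (suc (K + d))) e refl
          | m≡n+o⇒m∸n≡o (suc (suc (K + d) + e)) (K + d) (suc (suc e)) (eq₂ K d e)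
          | ∣-∣≡ʳ (suc (K + d)) K (suc d) (sym (+-suc K d)) = ring₁ K d e
  byCases .(q + 1) q (inj₂ (zero , refl))
    rewrite κ≡suc-q q (q + 1) (≤-reflexive (+-comm 1 q)) | κ≡q (suc q) (q + 1) (≤-reflexive (+-comm q 1))
          | ∣-∣≡ʳ (suc q) (q + 1) 0 (sym (trans (+-identityʳ (q + 1)) (+-comm q 1)))
          | m≡n+o⇒m∸n≡o (suc (suc q) + e) (suc q) (suc e) (eq₃ q e)
          | m≡n+o⇒m∸n≡o (suc (suc q) + e) (suc (suc q)) e refl = ring₂ q e
  byCases .(q + suc (suc d)) q (inj₂ (suc d , refl))
    rewrite κ≡suc-q q (q + suc (suc d)) (≤-trans (s≤s (m≤m+n q (suc d))) (≤-reflexive (sym (+-suc q (suc d)))))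
          | κ≡suc-q (suc q) (q + suc (suc d)) (≤-trans (m≤m+n (suc (suc q)) d) (≤-reflexive (eq₄ q d)))
          | ∣-∣≡ˡ (q + suc (suc d)) (suc q) (suc d) (+-suc q (suc d))
          | ∣-∣≡ˡ (q + suc (suc d)) (suc (suc q)) d (sym (eq₄ q d))
          | m≡n+o⇒m∸n≡o (suc (suc q) + e) (suc q) (suc e) (eq₃ q e)
          | m≡n+o⇒m∸n≡o (suc (suc q) + e) (suc (suc q)) e refl = ring₃ q d e

κ-lipschitz : ∀ q K K′ → ∣ κ q K - K ∣ + ∣ κ q K - κ q K′ ∣ ≤ ∣ κ q K′ - K′ ∣ + ∣ K - K′ ∣
κ-lipschitz q K K′ with ≤-<-connex K q | ≤-<-connex K′ q
... | inj₁ a | inj₁ b rewrite κ≡q q K a | κ≡q q K′ b | ∣n-n∣≡0 q | +-identityʳ ∣ q - K ∣ =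
  ≤-trans (∣-∣-triangle q K′ K) (≤-reflexive (cong (∣ q - K′ ∣ +_) (∣-∣-comm K′ K)))
... | inj₂ a | inj₂ b rewrite κ≡suc-q q K a | κ≡suc-q q K′ b | ∣n-n∣≡0 q | +-identityʳ ∣ suc q - K ∣ =
  ≤-trans (∣-∣-triangle (suc q) K′ K) (≤-reflexive (cong (∣ suc q - K′ ∣ +_) (∣-∣-comm K′ K)))
... | inj₁ a | inj₂ b rewrite κ≡q q K a | κ≡suc-q q K′ b | m≤n⇒∣n-m∣≡n∸m a | m≤n⇒∣m-n∣≡n∸m b
                            | m≤n⇒∣m-n∣≡n∸m (≤-trans a (<⇒≤ b)) | ∣n-suc-n∣≡1 q =
  begin (q ∸ K) + 1 ≡⟨ +-comm (q ∸ K) 1 ⟩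
        suc (q ∸ K) ≡⟨ sym (+-∸-assoc 1 a) ⟩
        suc q ∸ K ≤⟨ ∸-monoˡ-≤ K b ⟩
        K′ ∸ K ≤⟨ m≤n+m (K′ ∸ K) (K′ ∸ suc q) ⟩
        (K′ ∸ suc q) + (K′ ∸ K) ∎
  where open ≤-Reasoning
... | inj₂ a | inj₁ b rewrite κ≡suc-q q K a | κ≡q q K′ b | m≤n⇒∣n-m∣≡n∸m b | m≤n⇒∣m-n∣≡n∸m a
                            | m≤n⇒∣n-m∣≡n∸m (≤-trans b (<⇒≤ a)) | ∣suc-n-n∣≡1 q =
  begin (K ∸ suc q) + 1 ≡⟨ +-comm (K ∸ suc q) 1 ⟩
        suc (K ∸ suc q) ≡⟨ sym (∸-suc a) ⟩
        K ∸ q ≤⟨ ∸-monoʳ-≤ K b ⟩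
        K ∸ K′ ≤⟨ m≤n+m (K ∸ K′) (q ∸ K′) ⟩
        (q ∸ K′) + (K ∸ K′) ∎
  where open ≤-Reasoning

ψ-lipschitz : ∀ m q K K′ → ψ m q K + ∣ κ q K - κ q K′ ∣ ≤ ψ m q K′ + ∣ K - K′ ∣
ψ-lipschitz m q K K′ =
  begin q * (m ∸ suc q) + ∣ κ q K - K ∣ + ∣ κ q K - κ q K′ ∣
          ≡⟨ +-assoc (q * (m ∸ suc q)) _ _ ⟩
        q * (m ∸ suc q) + (∣ κ q K - K ∣ + ∣ κ q K - κ q K′ ∣)
          ≤⟨ +-monoʳ-≤ (q * (m ∸ suc q)) (κ-lipschitz q K K′) ⟩
        q * (m ∸ suc q) + (∣ κ q K′ - K′ ∣ + ∣ K - K′ ∣)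
          ≡⟨ sym (+-assoc (q * (m ∸ suc q)) _ _) ⟩
        q * (m ∸ suc q) + ∣ κ q K′ - K′ ∣ + ∣ K - K′ ∣ ∎
  where open ≤-Reasoning

κ-V : ∀ q c K → ∣ κ q c - c ∣ + ∣ K - κ q c ∣ ≤ ∣ κ q K - K ∣ + ∣ κ q K - c ∣
κ-V q c K with ≤-<-connex c q | ≤-<-connex K q
... | inj₁ a | inj₁ b rewrite κ≡q q c a | κ≡q q K b =
  ≤-reflexive (trans (+-comm ∣ q - c ∣ ∣ K - q ∣) (cong (_+ ∣ q - c ∣) (∣-∣-comm K q)))
... | inj₂ a | inj₂ b rewrite κ≡suc-q q c a | κ≡suc-q q K b =
  ≤-reflexive (trans (+-comm ∣ suc q - c ∣ ∣ K - suc q ∣) (cong (_+ ∣ suc q - c ∣) (∣-∣-comm K (suc q))))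
... | inj₁ a | inj₂ b rewrite κ≡q q c a | κ≡suc-q q K b | m≤n⇒∣n-m∣≡n∸m a | m≤n⇒∣n-m∣≡n∸m (<⇒≤ b)
                            | m≤n⇒∣m-n∣≡n∸m b | m≤n⇒∣n-m∣≡n∸m (m≤n⇒m≤1+n a) =
  ≤-reflexive (trans (∸-chain a (<⇒≤ b)) (sym (trans (+-comm (K ∸ suc q) (suc q ∸ c)) (∸-chain (m≤n⇒m≤1+n a) b))))
... | inj₂ a | inj₁ b rewrite κ≡suc-q q c a | κ≡q q K b | m≤n⇒∣m-n∣≡n∸m a | m≤n⇒∣m-n∣≡n∸m (m≤n⇒m≤1+n b)
                            | m≤n⇒∣n-m∣≡n∸m b | m≤n⇒∣m-n∣≡n∸m (<⇒≤ a) =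
  ≤-reflexive (trans (trans (+-comm (c ∸ suc q) (suc q ∸ K)) (∸-chain (m≤n⇒m≤1+n b) a)) (sym (∸-chain b (<⇒≤ a))))

κ-complement : ∀ m q K → q < m → K ≤ m → m ∸ κ (m ∸ suc q) (m ∸ K) ≡ κ q K
κ-complement m q K q<m K≤m with m≤n⇒∃[o]m+o≡n q<m
... | e , refl rewrite m+n∸m≡n (suc q) e with ≤-<-connex K q
...   | inj₁ Kq rewrite κ≡q q K Kq
         | κ≡suc-q e (suc q + e ∸ K) (≤-trans (s≤s (m≤n+m e (q ∸ K))) (≤-reflexive (sym (trans (+-∸-comm e (m≤n⇒m≤1+n Kq)) (cong (_+ e) (+-∸-assoc 1 Kq))))))
         = m+n∸n≡m q e
...   | inj₂ qK rewrite κ≡suc-q q K qK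
         | κ≡q e (suc q + e ∸ K) (≤-trans (∸-monoʳ-≤ (suc q + e) qK) (≤-reflexive (m+n∸m≡n (suc q) e)))
         = m+n∸n≡m (suc q) e

κ-complement′ : ∀ m q K → q < m → K ≤ m → κ (m ∸ suc q) (m ∸ K) ≡ m ∸ κ q K
κ-complement′ m q K q<m K≤m = trans (sym (m∸[m∸n]≡n (κ≤m m (m ∸ suc q) (m ∸ K) m∸suc-q<m))) (cong (m ∸_) (κ-complement m q K q<m K≤m))
  where
  m∸suc-q<m : m ∸ suc q < m
  m∸suc-q<m = ≤-trans (≤-reflexive (sym (∸-suc q<m))) (m∸n≤m m q)

ψ-complement : ∀ m q K → q < m → K ≤ m → ψ m (m ∸ suc q) (m ∸ K) ≡ ψ m q K
ψ-complement m q K q<m K≤m =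
  cong₂ _+_ pairs-flip
    (trans (cong (λ z → ∣ z - (m ∸ K) ∣) κ-flip)
      (∣∸-∸∣ m (κ q K) K (κ≤m m q K q<m) K≤m))
  where
  m∸suc-q<m : m ∸ suc q < m
  m∸suc-q<m = ≤-trans (≤-reflexive (sym (∸-suc q<m))) (m∸n≤m m q)
  κ-flip : κ (m ∸ suc q) (m ∸ K) ≡ m ∸ κ q K
  κ-flip = trans (sym (m∸[m∸n]≡n (κ≤m m (m ∸ suc q) (m ∸ K) m∸suc-q<m))) (cong (m ∸_) (κ-complement m q K q<m K≤m))
  pairs-flip : (m ∸ suc q) * (m ∸ suc (m ∸ suc q)) ≡ q * (m ∸ suc q)
  pairs-flip with m≤n⇒∃[o]m+o≡n q<m
  ... | e , refl rewrite m+n∸m≡n (suc q) e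
          | m+n∸n≡m q e = *-comm e q

blockPairs-+ : ∀ m q₁ q₂ → q₁ + q₂ < m →
  blockPairs m q₁ + blockPairs m q₂ ≡ blockPairs m (q₁ + q₂) + 2 * (q₁ * q₂)
blockPairs-+ m q₁ q₂ h with m≤n⇒∃[o]m+o≡n h
... | e , refl = expanded q₁ q₂ e
  where
  regroup₁ : ∀ q₁ q₂ e → suc (q₁ + q₂) + e ≡ suc q₁ + (q₂ + e)
  regroup₁ = solve-∀
  regroup₂ : ∀ q₁ q₂ e → suc (q₁ + q₂) + e ≡ suc q₂ + (q₁ + e)
  regroup₂ = solve-∀
  expand : ∀ q₁ q₂ e → q₁ * (q₂ + e) + q₂ * (q₁ + e) ≡ (q₁ + q₂) * e + 2 * (q₁ * q₂)
  expand = solve-∀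
  expanded : ∀ q₁ q₂ e → let m = suc (q₁ + q₂) + e in
    blockPairs m q₁ + blockPairs m q₂ ≡ blockPairs m (q₁ + q₂) + 2 * (q₁ * q₂)
  expanded q₁ q₂ e rewrite m+n∸m≡n (suc (q₁ + q₂)) e
    | m≡n+o⇒m∸n≡o (suc (q₁ + q₂) + e) (suc q₁) (q₂ + e) (regroup₁ q₁ q₂ e)
    | m≡n+o⇒m∸n≡o (suc (q₁ + q₂) + e) (suc q₂) (q₁ + e) (regroup₂ q₁ q₂ e) = expand q₁ q₂ e

κ-shift : ∀ q₁ q₂ u → 1 ≤ q₂ → ∣ κ (q₁ + q₂) u - κ q₁ u ∣ ≤ q₂
κ-shift q₁ (suc q₂) u h with ≤-<-connex u (q₁ + suc q₂) | ≤-<-connex u q₁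
... | inj₁ a | inj₁ b rewrite κ≡q (q₁ + suc q₂) u a | κ≡q q₁ u b | ∣m+n-m∣≡n q₁ (suc q₂) = ≤-refl
... | inj₂ a | inj₂ b rewrite κ≡suc-q (q₁ + suc q₂) u a | κ≡suc-q q₁ u b | ∣m+n-m∣≡n q₁ (suc q₂) = ≤-refl
... | inj₁ a | inj₂ b rewrite κ≡q (q₁ + suc q₂) u a | κ≡suc-q q₁ u b | +-suc q₁ q₂ | ∣m+n-m∣≡n q₁ q₂ = n≤1+n q₂
... | inj₂ a | inj₁ b = ⊥-elim (<⇒≱ (≤-trans (s≤s (m≤m+n q₁ (suc q₂))) a) b)

ψ-merge : ∀ m q₁ q₂ u v → 1 ≤ q₁ → 1 ≤ q₂ → q₁ + q₂ < m →
  ψ m (q₁ + q₂) u + ∣ κ (q₁ + q₂) u - κ q₁ u ∣ + v ≤ ψ m q₁ u + (ψ m q₂ v + κ q₂ v)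
ψ-merge m q₁ q₂ u v h1 h2 hm =
  begin PQ + AQ + D + v
        ≤⟨ +-monoˡ-≤ v (+-monoˡ-≤ D (+-monoʳ-≤ PQ (∣-∣-triangle (κ Q u) (κ q₁ u) u))) ⟩
        PQ + (D + A1) + D + v
        ≤⟨ +-monoʳ-≤ (PQ + (D + A1) + D) (m≤∣m-n∣+n v (κ q₂ v)) ⟩
        PQ + (D + A1) + D + (∣ v - κ q₂ v ∣ + κ q₂ v)
        ≡⟨ cong (λ z → PQ + (D + A1) + D + (z + κ q₂ v)) (∣-∣-comm v (κ q₂ v)) ⟩
        PQ + (D + A1) + D + (A2 + κ q₂ v)
        ≡⟨ collect PQ D A1 A2 (κ q₂ v) ⟩
        PQ + 2 * D + A1 + A2 + κ q₂ v
        ≤⟨ +-monoˡ-≤ (κ q₂ v) (+-monoˡ-≤ A2 (+-monoˡ-≤ A1 (+-monoʳ-≤ PQ (*-monoʳ-≤ 2 Dq)))) ⟩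
        PQ + 2 * (q₁ * q₂) + A1 + A2 + κ q₂ v
        ≡⟨ cong (λ z → z + A1 + A2 + κ q₂ v) (sym (blockPairs-+ m q₁ q₂ hm)) ⟩
        blockPairs m q₁ + blockPairs m q₂ + A1 + A2 + κ q₂ v
        ≡⟨ regroup (blockPairs m q₁) (blockPairs m q₂) A1 A2 (κ q₂ v) ⟩
        blockPairs m q₁ + A1 + (blockPairs m q₂ + A2 + κ q₂ v) ∎
  where
  open ≤-Reasoning
  Q = q₁ + q₂
  PQ = blockPairs m Q
  AQ = ∣ κ Q u - u ∣
  D = ∣ κ Q u - κ q₁ u ∣
  A1 = ∣ κ q₁ u - u ∣
  A2 = ∣ κ q₂ v - v ∣
  Dq : D ≤ q₁ * q₂
  Dq = ≤-trans (κ-shift q₁ q₂ u h2) (≤-trans (≤-reflexive (sym (*-identityˡ q₂))) (*-monoˡ-≤ q₂ h1))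
  collect : ∀ a b c d e → a + (b + c) + b + (d + e) ≡ a + 2 * b + c + d + e
  collect = solve-∀
  regroup : ∀ a b c d e → a + b + c + d + e ≡ a + c + (b + d + e)
  regroup = solve-∀

ψ-merge-empty : ∀ m q₂ u v → 1 ≤ q₂ → u + ∣ κ q₂ v - κ 0 u ∣ ≤ ψ m 0 u + κ q₂ v
ψ-merge-empty m q₂ zero v h = ≤-reflexive (∣-∣-identityʳ (κ q₂ v))
ψ-merge-empty m q₂ (suc u) v h = ≤-reflexive (trans (cong (suc u +_) (m≤n⇒∣n-m∣≡n∸m (≤-trans h (q≤κ q₂ v))))
                                    (sym (m≤n⇒m+[n∸m]≡n' u (κ q₂ v) (≤-trans h (q≤κ q₂ v)))))
  where
  m≤n⇒m+[n∸m]≡n' : ∀ u k → 1 ≤ k → u + k ≡ suc u + (k ∸ 1)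
  m≤n⇒m+[n∸m]≡n' u (suc k) _ = +-suc u k

ψ-merge-overflow : ∀ m q₁ q₂ u v → 1 ≤ q₁ → 1 ≤ q₂ → q₁ + q₂ ≡ m →
  (m ∸ u) + v ≤ (ψ m q₁ u + κ q₁ u) + (ψ m q₂ v + κ q₂ v)
ψ-merge-overflow m q₁ q₂ u v h1 h2 refl =
  begin (q₁ + q₂ ∸ u) + v
        ≤⟨ +-mono-≤ (∸≤∣-∣+∸ (q₁ + q₂) u (κ q₁ u)) (m≤∣m-n∣+n v (κ q₂ v)) ⟩
        (∣ κ q₁ u - u ∣ + (q₁ + q₂ ∸ κ q₁ u)) + (∣ v - κ q₂ v ∣ + κ q₂ v)
        ≤⟨ +-mono-≤ (+-monoʳ-≤ ∣ κ q₁ u - u ∣ (≤-trans (∸-monoʳ-≤ (q₁ + q₂) (q≤κ q₁ u)) (≤-reflexive (m+n∸m≡n q₁ q₂))))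
                    (≤-reflexive (cong (_+ κ q₂ v) (∣-∣-comm v (κ q₂ v)))) ⟩
        (∣ κ q₁ u - u ∣ + q₂) + (∣ κ q₂ v - v ∣ + κ q₂ v)
        ≤⟨ +-monoˡ-≤ (∣ κ q₂ v - v ∣ + κ q₂ v) (+-monoʳ-≤ ∣ κ q₁ u - u ∣ (q₂≤ q₁ q₂ h1 h2)) ⟩
        (∣ κ q₁ u - u ∣ + (blockPairs (q₁ + q₂) q₁ + q₁)) + (∣ κ q₂ v - v ∣ + κ q₂ v)
        ≤⟨ +-monoˡ-≤ (∣ κ q₂ v - v ∣ + κ q₂ v) (+-monoʳ-≤ ∣ κ q₁ u - u ∣ (+-monoʳ-≤ (blockPairs (q₁ + q₂) q₁) (q≤κ q₁ u))) ⟩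
        (∣ κ q₁ u - u ∣ + (blockPairs (q₁ + q₂) q₁ + κ q₁ u)) + (∣ κ q₂ v - v ∣ + κ q₂ v)
        ≤⟨ +-monoʳ-≤ (∣ κ q₁ u - u ∣ + (blockPairs (q₁ + q₂) q₁ + κ q₁ u)) (+-monoˡ-≤ (κ q₂ v) (m≤n+m ∣ κ q₂ v - v ∣ (blockPairs (q₁ + q₂) q₂))) ⟩
        (∣ κ q₁ u - u ∣ + (blockPairs (q₁ + q₂) q₁ + κ q₁ u)) + (blockPairs (q₁ + q₂) q₂ + ∣ κ q₂ v - v ∣ + κ q₂ v)
        ≡⟨ cong (_+ (blockPairs (q₁ + q₂) q₂ + ∣ κ q₂ v - v ∣ + κ q₂ v)) (x∙yz≈yx∙z ∣ κ q₁ u - u ∣ (blockPairs (q₁ + q₂) q₁) (κ q₁ u)) ⟩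
        (blockPairs (q₁ + q₂) q₁ + ∣ κ q₁ u - u ∣ + κ q₁ u) + (blockPairs (q₁ + q₂) q₂ + ∣ κ q₂ v - v ∣ + κ q₂ v) ∎
  where
  open ≤-Reasoning
  q₂≤ : ∀ q₁ q₂ → 1 ≤ q₁ → 1 ≤ q₂ → q₂ ≤ blockPairs (q₁ + q₂) q₁ + q₁
  q₂≤ (suc q₁) (suc q₂) _ _ rewrite +-suc q₁ q₂ | m+n∸m≡n q₁ q₂ =
    ≤-trans (s≤s (m≤m+n q₂ (q₁ * q₂ + q₁))) (≤-reflexive (expand q₁ q₂))
    where
    expand : ∀ q₁ q₂ → suc (q₂ + (q₁ * q₂ + q₁)) ≡ (q₂ + q₁ * q₂) + suc q₁
    expand = solve-∀

κ-bridge : ∀ f K′ k′ b → ∣ κ f (⟦ b ⟧ + K′) - (⟦ b ⟧ + K′) ∣ + ∣ (⟦ b ⟧ + k′) - κ f (⟦ b ⟧ + K′) ∣ ≤ ∣ K′ - f ∣ + ∣ k′ - f ∣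
κ-bridge f K′ k′ false with ≤-<-connex K′ f
... | inj₁ h rewrite κ≡q f K′ h = ≤-reflexive (cong (_+ ∣ k′ - f ∣) (∣-∣-comm f K′))
... | inj₂ h rewrite κ≡suc-q f K′ h =
  begin ∣ suc f - K′ ∣ + ∣ k′ - suc f ∣
        ≤⟨ +-monoʳ-≤ ∣ suc f - K′ ∣ (∣-∣-triangle k′ f (suc f)) ⟩
        ∣ suc f - K′ ∣ + (∣ k′ - f ∣ + ∣ f - suc f ∣)
        ≡⟨ cong (λ z → ∣ suc f - K′ ∣ + (∣ k′ - f ∣ + z)) (∣n-suc-n∣≡1 f) ⟩
        ∣ suc f - K′ ∣ + (∣ k′ - f ∣ + 1)
        ≡⟨ shift-one ∣ suc f - K′ ∣ ∣ k′ - f ∣ ⟩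
        suc ∣ suc f - K′ ∣ + ∣ k′ - f ∣
        ≡⟨ cong (λ z → suc z + ∣ k′ - f ∣) (m≤n⇒∣m-n∣≡n∸m h) ⟩
        suc (K′ ∸ suc f) + ∣ k′ - f ∣
        ≡⟨ cong (_+ ∣ k′ - f ∣) (sym (trans (m≤n⇒∣n-m∣≡n∸m (<⇒≤ h)) (∸-suc h))) ⟩
        ∣ K′ - f ∣ + ∣ k′ - f ∣ ∎
  where
  open ≤-Reasoning
  shift-one : ∀ a b → a + (b + 1) ≡ suc a + b
  shift-one = solve-∀
κ-bridge f K′ k′ true with ≤-<-connex (suc K′) f
... | inj₂ h rewrite κ≡suc-q f (suc K′) h = ≤-reflexive (cong (_+ ∣ k′ - f ∣) (∣-∣-comm f K′))
... | inj₁ h rewrite κ≡q f (suc K′) h =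
  begin ∣ f - suc K′ ∣ + ∣ suc k′ - f ∣
        ≤⟨ +-monoʳ-≤ ∣ f - suc K′ ∣ (∣-∣-triangle (suc k′) k′ f) ⟩
        ∣ f - suc K′ ∣ + (∣ suc k′ - k′ ∣ + ∣ k′ - f ∣)
        ≡⟨ cong (λ z → ∣ f - suc K′ ∣ + (z + ∣ k′ - f ∣)) (∣suc-n-n∣≡1 k′) ⟩
        ∣ f - suc K′ ∣ + suc ∣ k′ - f ∣
        ≡⟨ +-suc ∣ f - suc K′ ∣ ∣ k′ - f ∣ ⟩
        suc ∣ f - suc K′ ∣ + ∣ k′ - f ∣
        ≡⟨ cong (λ z → suc z + ∣ k′ - f ∣) (m≤n⇒∣n-m∣≡n∸m h) ⟩
        suc (f ∸ suc K′) + ∣ k′ - f ∣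
        ≡⟨ cong (_+ ∣ k′ - f ∣) (sym (trans (m≤n⇒∣m-n∣≡n∸m (<⇒≤ h)) (∸-suc h))) ⟩
        ∣ K′ - f ∣ + ∣ k′ - f ∣ ∎
  where open ≤-Reasoning

count≡sumˡ : ∀ {A : Set} (P : A → Bool) xs → length (filterᵇ P xs) ≡ sumˡ (map (λ x → ⟦ P x ⟧) xs)
count≡sumˡ P [] = refl
count≡sumˡ P (x ∷ xs) with P x
... | true = cong suc (count≡sumˡ P xs)
... | false = count≡sumˡ P xs

sumˡ-map-concatMap : ∀ {A B : Set} (g : B → ℕ) (h : A → List B) xs →
  sumˡ (map g (concatMap h xs)) ≡ sumˡ (map (λ a → sumˡ (map g (h a))) xs)
sumˡ-map-concatMap g h [] = refl
sumˡ-map-concatMap g h (x ∷ xs) = trans (cong sumˡ (map-++ g (h x) (concatMap h xs)))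
  (trans (sumˡ-++ (map g (h x)) _) (cong (sumˡ (map g (h x)) +_) (sumˡ-map-concatMap g h xs)))

sumˡ-map-cartesianProduct : ∀ {A B : Set} (g : A × B → ℕ) xs ys →
  sumˡ (map g (cartesianProduct xs ys)) ≡ sumˡ (map (λ x → sumˡ (map (λ y → g (x , y)) ys)) xs)
sumˡ-map-cartesianProduct g [] ys = refl
sumˡ-map-cartesianProduct g (x ∷ xs) ys =
  trans (cong sumˡ (map-++ g (map (x ,_) ys) (cartesianProduct xs ys)))
    (trans (sumˡ-++ (map g (map (x ,_) ys)) _)
      (cong₂ _+_ (cong sumˡ (sym (map-∘ ys))) (sumˡ-map-cartesianProduct g xs ys)))

sumˡ-tabulate : ∀ j (h : Fin j → ℕ) → sumˡ (tabulate h) ≡ sum h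
sumˡ-tabulate zero h = refl
sumˡ-tabulate (suc j) h = cong (h zero +_) (sumˡ-tabulate j (h ∘ suc))

sumˡ-map-allFin : ∀ j (g : Fin j → ℕ) → sumˡ (map g (allFin j)) ≡ sum g
sumˡ-map-allFin j g = trans (cong sumˡ (map-tabulate id g)) (sumˡ-tabulate j g)

-- digits M j ℓ = (q , r) with ℓ = q M + r and 0 < r ≤ M unless ℓ = 0: the partial block is
-- never empty, so a multiple of M ends with a full block.
digits : ℕ → ℕ → ℕ → ℕ × ℕ
digits M zero ℓ = (0 , ℓ)
digits M (suc j) ℓ =
  if ℓ ≤ᵇ M then (0 , ℓ) else (suc (proj₁ (digits M j (ℓ ∸ M))) , proj₂ (digits M j (ℓ ∸ M)))

digits-spec : ∀ M j ℓ → ℓ ≤ suc j * M →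
  proj₁ (digits M j ℓ) ≤ j × proj₂ (digits M j ℓ) ≤ M × ℓ ≡ proj₁ (digits M j ℓ) * M + proj₂ (digits M j ℓ)
digits-spec M zero ℓ h = z≤n , ≤-trans h (≤-reflexive (+-identityʳ M)) , refl
digits-spec M (suc j) ℓ h with ℓ ≤ᵇ M in e
... | true = z≤n , ≤ᵇ⇒≤ ℓ M (subst T (sym e) tt) , refl
... | false = shift (digits-spec M j (ℓ ∸ M) (≤-trans (∸-monoˡ-≤ M h) (≤-reflexive (m+n∸m≡n M (suc j * M)))))
  where
  M<ℓ : M < ℓ
  M<ℓ = ≰⇒> (λ h → subst T e (≤⇒≤ᵇ h))
  shift : ∀ {q r} → q ≤ j × r ≤ M × ℓ ∸ M ≡ q * M + r → suc q ≤ suc j × r ≤ M × ℓ ≡ suc q * M + r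
  shift (q≤j , r≤M , eq) =
    s≤s q≤j , r≤M , trans (sym (m+[n∸m]≡n (<⇒≤ M<ℓ))) (trans (cong (M +_) eq) (sym (+-assoc M _ _)))

digits-zero : ∀ M j → digits M j 0 ≡ (0 , 0)
digits-zero M zero = refl
digits-zero M (suc j) = refl

digits-canonical : ∀ M j q r → q ≤ j → r ≤ M → 0 < r → digits M j (q * M + r) ≡ (q , r)
digits-canonical M zero zero r _ r≤M _ = refl
digits-canonical M (suc j) zero r _ r≤M _ rewrite ≤ᵇ-true r≤M = refl
digits-canonical M (suc j) (suc q) r (s≤s q≤j) r≤M 0<r
  rewrite +-assoc M (q * M) r | ≤ᵇ-false (m<m+n M (<-≤-trans 0<r (m≤n+m r (q * M))))
        | m+n∸m≡n M (q * M + r) | digits-canonical M j q r q≤j r≤M 0<r = refl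

digits-≤ : ∀ M j ℓ → proj₁ (digits M j ℓ) ≤ j
digits-≤ M zero ℓ = z≤n
digits-≤ M (suc j) ℓ with ℓ ≤ᵇ M
... | true = z≤n
... | false = s≤s (digits-≤ M j (ℓ ∸ M))

module SierpinskiCut (m₀ : ℕ) where

  m : ℕ
  m = suc m₀

  fullBlocks : ℕ → ℕ → ℕ
  fullBlocks n ℓ = proj₁ (digits (m ^ n) m₀ ℓ)

  partBlock : ℕ → ℕ → ℕ
  partBlock n ℓ = proj₂ (digits (m ^ n) m₀ ℓ)

  φ : ℕ → ℕ → ℕ → ℕ
  φ zero ℓ K = if ℓ ≡ᵇ 0 then K else m ∸ K
  φ (suc n) ℓ K = ψ m (fullBlocks n ℓ) K + φ n (partBlock n ℓ) (κ (fullBlocks n ℓ) K)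

  lexCorners : ℕ → ℕ → ℕ
  lexCorners zero ℓ = if ℓ ≡ᵇ 0 then 0 else m
  lexCorners (suc n) ℓ = κ (fullBlocks n ℓ) (lexCorners n (partBlock n ℓ))

  digits-bounds : ∀ n ℓ → ℓ ≤ m ^ suc n →
    fullBlocks n ℓ < m × partBlock n ℓ ≤ m ^ n × ℓ ≡ fullBlocks n ℓ * m ^ n + partBlock n ℓ
  digits-bounds n ℓ h with digits-spec (m ^ n) m₀ ℓ h
  ... | a , b , c = s≤s a , b , c

  fullBlocks<m : ∀ n ℓ → fullBlocks n ℓ < m
  fullBlocks<m n ℓ = s≤s (digits-≤ (m ^ n) m₀ ℓ)

  lexCorners≤m : ∀ n ℓ → lexCorners n ℓ ≤ m
  lexCorners≤m zero ℓ with ℓ ≡ᵇ 0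
  ... | true = z≤n
  ... | false = ≤-refl
  lexCorners≤m (suc n) ℓ = κ≤m m (fullBlocks n ℓ) (lexCorners n (partBlock n ℓ)) (fullBlocks<m n ℓ)

  φ-empty : ∀ n K → φ n 0 K ≡ K
  φ-empty zero K = refl
  φ-empty (suc n) K rewrite digits-zero (m ^ n) m₀ | φ-empty n (κ 0 K) = ψ-zero m K

  φ-full : ∀ n K → K ≤ m → φ n (m ^ n) K ≡ m ∸ K
  φ-full zero K h = refl
  φ-full (suc n) K h
    rewrite +-comm (m ^ n) (m₀ * m ^ n) | digits-canonical (m ^ n) m₀ m₀ (m ^ n) ≤-refl ≤-refl (m^n>0 m n)
          | φ-full n (κ m₀ K) (κ≤m m m₀ K ≤-refl) = ψ-last m₀ K h

  φ-digits : ∀ n q r K → q < m → r ≤ m ^ n → K ≤ m → φ (suc n) (q * m ^ n + r) K ≡ ψ m q K + φ n r (κ q K)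
  φ-digits n zero zero K _ _ _ rewrite digits-zero (m ^ n) m₀ = refl
  φ-digits n (suc q) zero K q<m _ K≤m
    rewrite +-identityʳ (m ^ n + q * m ^ n) | +-comm (m ^ n) (q * m ^ n)
          | digits-canonical (m ^ n) m₀ q (m ^ n) (≤-pred (≤-trans (s≤s (n≤1+n q)) q<m)) ≤-refl (m^n>0 m n)
          | φ-full n (κ q K) (κ≤m m q K (≤-trans (n≤1+n (suc q)) q<m))
          | φ-empty n (κ (suc q) K) = ψ-step m q K q<m K≤m
  φ-digits n q (suc r) K q<m r≤M _
    rewrite digits-canonical (m ^ n) m₀ q (suc r) (≤-pred q<m) r≤M (s≤s z≤n) = refl

  φ-lipschitz : ∀ n ℓ K K′ → φ n ℓ K ≤ φ n ℓ K′ + ∣ K - K′ ∣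
  φ-lipschitz zero ℓ K K′ with ℓ ≡ᵇ 0
  ... | true = m≤n+∣m-n∣ K K′
  ... | false = ≤-trans (∸≤∣-∣+∸ m K K′) (≤-reflexive (trans (+-comm _ (m ∸ K′)) (cong ((m ∸ K′) +_) (∣-∣-comm K′ K))))
  φ-lipschitz (suc n) ℓ K K′ =
    begin ψ m q K + φ n r (κ q K)
          ≤⟨ +-monoʳ-≤ (ψ m q K) (φ-lipschitz n r (κ q K) (κ q K′)) ⟩
          ψ m q K + (φ n r (κ q K′) + ∣ κ q K - κ q K′ ∣)
          ≡⟨ x∙yz≈xz∙y (ψ m q K) (φ n r (κ q K′)) ∣ κ q K - κ q K′ ∣ ⟩
          ψ m q K + ∣ κ q K - κ q K′ ∣ + φ n r (κ q K′)
          ≤⟨ +-monoˡ-≤ (φ n r (κ q K′)) (ψ-lipschitz m q K K′) ⟩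
          ψ m q K′ + ∣ K - K′ ∣ + φ n r (κ q K′)
          ≡⟨ xy∙z≈xz∙y (ψ m q K′) ∣ K - K′ ∣ (φ n r (κ q K′)) ⟩
          ψ m q K′ + φ n r (κ q K′) + ∣ K - K′ ∣ ∎
    where
    open ≤-Reasoning
    q = fullBlocks n ℓ
    r = partBlock n ℓ

  φ-complement : ∀ n ℓ K → ℓ ≤ m ^ n → K ≤ m → φ n (m ^ n ∸ ℓ) (m ∸ K) ≡ φ n ℓ K
  φ-complement zero zero K h K≤m = m∸[m∸n]≡n K≤m
  φ-complement zero (suc zero) K h K≤m = refl
  φ-complement zero (suc (suc ℓ)) K (s≤s ()) K≤m
  φ-complement (suc n) ℓ K h K≤m with digits-bounds n ℓ h
  ... | q<m , r≤M , e =
    begin φ (suc n) (m ^ suc n ∸ ℓ) (m ∸ K)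
          ≡⟨ cong (λ z → φ (suc n) (m ^ suc n ∸ z) (m ∸ K)) e ⟩
          φ (suc n) (m ^ suc n ∸ (q * m ^ n + r)) (m ∸ K)
          ≡⟨ cong (λ z → φ (suc n) z (m ∸ K)) (complement-digits m₀ (m ^ n) q r (≤-pred q<m) r≤M) ⟩
          φ (suc n) ((m₀ ∸ q) * m ^ n + (m ^ n ∸ r)) (m ∸ K)
          ≡⟨ φ-digits n (m₀ ∸ q) (m ^ n ∸ r) (m ∸ K) (s≤s (m∸n≤m m₀ q)) (m∸n≤m (m ^ n) r) (m∸n≤m m K) ⟩
          ψ m (m ∸ suc q) (m ∸ K) + φ n (m ^ n ∸ r) (κ (m ∸ suc q) (m ∸ K))
          ≡⟨ cong₂ _+_ (ψ-complement m q K q<m K≤m) (cong (φ n (m ^ n ∸ r)) (κ-complement′ m q K q<m K≤m)) ⟩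
          ψ m q K + φ n (m ^ n ∸ r) (m ∸ κ q K)
          ≡⟨ cong (ψ m q K +_) (φ-complement n r (κ q K) r≤M (κ≤m m q K q<m)) ⟩
          ψ m q K + φ n r (κ q K) ∎
    where
    open ≡-Reasoning
    q = fullBlocks n ℓ
    r = partBlock n ℓ

  φ-V : ∀ n ℓ K → ℓ ≤ m ^ n → K ≤ m → φ n ℓ (lexCorners n ℓ) + ∣ K - lexCorners n ℓ ∣ ≤ φ n ℓ K
  φ-V zero zero K h K≤m = ≤-reflexive (∣-∣-identityʳ K)
  φ-V zero (suc zero) K h K≤m rewrite n∸n≡0 m₀ = ≤-reflexive (m≤n⇒∣m-n∣≡n∸m K≤m)
  φ-V zero (suc (suc ℓ)) K (s≤s ()) K≤m
  φ-V (suc n) ℓ K h K≤m with digits-bounds n ℓ h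
  ... | q<m , r≤M , _ =
    begin ψ m q C' + φ n r (κ q C') + ∣ K - C' ∣
          ≡⟨ cong (λ z → ψ m q C' + φ n r z + ∣ K - C' ∣) (κ-idem q c) ⟩
          ψ m q C' + φ n r C' + ∣ K - C' ∣
          ≤⟨ +-monoˡ-≤ ∣ K - C' ∣ (+-monoʳ-≤ (ψ m q C') (φ-lipschitz n r C' c)) ⟩
          ψ m q C' + (φ n r c + ∣ C' - c ∣) + ∣ K - C' ∣
          ≡⟨ cong (λ z → blockPairs m q + z + (φ n r c + ∣ C' - c ∣) + ∣ K - C' ∣) (trans (cong (λ w → ∣ w - C' ∣) (κ-idem q c)) (∣n-n∣≡0 C')) ⟩
          blockPairs m q + 0 + (φ n r c + ∣ C' - c ∣) + ∣ K - C' ∣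
          ≡⟨ drop-zero (blockPairs m q) (φ n r c) ∣ C' - c ∣ ∣ K - C' ∣ ⟩
          blockPairs m q + φ n r c + (∣ C' - c ∣ + ∣ K - C' ∣)
          ≤⟨ +-monoʳ-≤ (blockPairs m q + φ n r c) (≤-trans (≤-reflexive (cong (λ w → ∣ w - c ∣ + ∣ K - w ∣) refl)) (κ-V q c K)) ⟩
          blockPairs m q + φ n r c + (∣ κ q K - K ∣ + ∣ κ q K - c ∣)
          ≡⟨ interchange (blockPairs m q) (φ n r c) ∣ κ q K - K ∣ ∣ κ q K - c ∣ ⟩
          blockPairs m q + ∣ κ q K - K ∣ + (φ n r c + ∣ κ q K - c ∣)
          ≤⟨ +-monoʳ-≤ (blockPairs m q + ∣ κ q K - K ∣) (φ-V n r (κ q K) r≤M (κ≤m m q K q<m)) ⟩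
          ψ m q K + φ n r (κ q K) ∎
    where
    open ≤-Reasoning
    q = fullBlocks n ℓ
    r = partBlock n ℓ
    c = lexCorners n r
    C' = κ q c
    drop-zero : ∀ a b c d → a + 0 + (b + c) + d ≡ a + b + (c + d)
    drop-zero = solve-∀

  φ-fullBlocks : ∀ n q v → q < m → v ≤ m → φ (suc n) (q * m ^ n) v ≡ ψ m q v + κ q v
  φ-fullBlocks n q v q<m v≤m =
    trans (cong (λ z → φ (suc n) z v) (sym (+-identityʳ _)))
      (trans (φ-digits n q 0 v q<m z≤n v≤m) (cong (ψ m q v +_) (φ-empty n (κ q v))))

  φ-pour-into-empty : ∀ n q₂ r u v → 1 ≤ q₂ → q₂ < m → r ≤ m ^ n → v ≤ m →
    φ (suc n) 0 u + φ (suc n) (q₂ * m ^ n + r) v ≤ ψ m 0 u + φ n r (κ 0 u) + φ (suc n) (q₂ * m ^ n) v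
  φ-pour-into-empty n q₂ r u v 1≤q₂ q₂<m r≤M v≤m = begin
    φ (suc n) 0 u + φ (suc n) (q₂ * m ^ n + r) v
      ≡⟨ cong₂ _+_ (φ-empty (suc n) u) (φ-digits n q₂ r v q₂<m r≤M v≤m) ⟩
    u + (ψ m q₂ v + φ n r (κ q₂ v))
      ≤⟨ +-monoʳ-≤ u (+-monoʳ-≤ (ψ m q₂ v) (φ-lipschitz n r (κ q₂ v) (κ 0 u))) ⟩
    u + (ψ m q₂ v + (φ n r (κ 0 u) + ∣ κ q₂ v - κ 0 u ∣))
      ≡⟨ shuffle₁ u (ψ m q₂ v) (φ n r (κ 0 u)) ∣ κ q₂ v - κ 0 u ∣ ⟩
    (u + ∣ κ q₂ v - κ 0 u ∣) + (ψ m q₂ v + φ n r (κ 0 u))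
      ≤⟨ +-monoˡ-≤ _ (ψ-merge-empty m q₂ u v 1≤q₂) ⟩
    (ψ m 0 u + κ q₂ v) + (ψ m q₂ v + φ n r (κ 0 u))
      ≡⟨ shuffle₂ (ψ m 0 u) (κ q₂ v) (ψ m q₂ v) (φ n r (κ 0 u)) ⟩
    ψ m 0 u + φ n r (κ 0 u) + (ψ m q₂ v + κ q₂ v)
      ≡⟨ cong (ψ m 0 u + φ n r (κ 0 u) +_) (φ-fullBlocks n q₂ v q₂<m v≤m) ⟨
    ψ m 0 u + φ n r (κ 0 u) + φ (suc n) (q₂ * m ^ n) v ∎
    where
    open ≤-Reasoning
    shuffle₁ : ∀ a b c d → a + (b + (c + d)) ≡ (a + d) + (b + c)
    shuffle₁ = solve-∀
    shuffle₂ : ∀ a b c d → (a + b) + (c + d) ≡ a + d + (c + b)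
    shuffle₂ = solve-∀

  φ-pour-merge : ∀ n q₁ q₂ r u v → 1 ≤ q₁ → 1 ≤ q₂ → q₁ + q₂ < m → r ≤ m ^ n → u ≤ m → v ≤ m →
    φ (suc n) ((q₁ + q₂) * m ^ n + r) u + φ (suc n) 0 v ≤ ψ m q₁ u + φ n r (κ q₁ u) + φ (suc n) (q₂ * m ^ n) v
  φ-pour-merge n q₁ q₂ r u v 1≤q₁ 1≤q₂ q<m r≤M u≤m v≤m = begin
    φ (suc n) (q * m ^ n + r) u + φ (suc n) 0 v
      ≡⟨ cong₂ _+_ (φ-digits n q r u q<m r≤M u≤m) (φ-empty (suc n) v) ⟩
    ψ m q u + φ n r (κ q u) + v
      ≤⟨ +-monoˡ-≤ v (+-monoʳ-≤ (ψ m q u) (φ-lipschitz n r (κ q u) (κ q₁ u))) ⟩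
    ψ m q u + (φ n r (κ q₁ u) + ∣ κ q u - κ q₁ u ∣) + v
      ≡⟨ shuffle₁ (ψ m q u) (φ n r (κ q₁ u)) ∣ κ q u - κ q₁ u ∣ v ⟩
    (ψ m q u + ∣ κ q u - κ q₁ u ∣ + v) + φ n r (κ q₁ u)
      ≤⟨ +-monoˡ-≤ _ (ψ-merge m q₁ q₂ u v 1≤q₁ 1≤q₂ q<m) ⟩
    (ψ m q₁ u + (ψ m q₂ v + κ q₂ v)) + φ n r (κ q₁ u)
      ≡⟨ shuffle₂ (ψ m q₁ u) (ψ m q₂ v + κ q₂ v) (φ n r (κ q₁ u)) ⟩
    ψ m q₁ u + φ n r (κ q₁ u) + (ψ m q₂ v + κ q₂ v)
      ≡⟨ cong (ψ m q₁ u + φ n r (κ q₁ u) +_) (φ-fullBlocks n q₂ v (≤-trans (s≤s (m≤n+m q₂ q₁)) q<m) v≤m) ⟨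
    ψ m q₁ u + φ n r (κ q₁ u) + φ (suc n) (q₂ * m ^ n) v ∎
    where
    open ≤-Reasoning
    q = q₁ + q₂
    shuffle₁ : ∀ a b c d → a + (b + c) + d ≡ (a + c + d) + b
    shuffle₁ = solve-∀
    shuffle₂ : ∀ a b c → (a + b) + c ≡ a + c + b
    shuffle₂ = solve-∀

  φ-pour-overflow : ∀ n q₁ q₂ u v → 1 ≤ q₁ → 1 ≤ q₂ → q₂ < m → q₁ + q₂ ≡ m → u ≤ m → v ≤ m →
    φ (suc n) (m ^ suc n) u + φ (suc n) 0 v ≤ ψ m q₁ u + φ n 0 (κ q₁ u) + φ (suc n) (q₂ * m ^ n) v
  φ-pour-overflow n q₁ q₂ u v 1≤q₁ 1≤q₂ q₂<m q≡m u≤m v≤m = begin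
    φ (suc n) (m ^ suc n) u + φ (suc n) 0 v
      ≡⟨ cong₂ _+_ (φ-full (suc n) u u≤m) (φ-empty (suc n) v) ⟩
    (m ∸ u) + v
      ≤⟨ ψ-merge-overflow m q₁ q₂ u v 1≤q₁ 1≤q₂ q≡m ⟩
    (ψ m q₁ u + κ q₁ u) + (ψ m q₂ v + κ q₂ v)
      ≡⟨ cong₂ _+_ (cong (ψ m q₁ u +_) (φ-empty n (κ q₁ u))) (φ-fullBlocks n q₂ v q₂<m v≤m) ⟨
    ψ m q₁ u + φ n 0 (κ q₁ u) + φ (suc n) (q₂ * m ^ n) v ∎
    where open ≤-Reasoning

  record Pour (n q₁ r q₂ u v : ℕ) : Set where
    constructor mkPour
    field
      a b : ℕ
      total : a + b ≡ q₁ * m ^ n + r + q₂ * m ^ n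
      a≤ : a ≤ m ^ suc n
      b≤ : b ≤ m ^ suc n
      empty : (a ≡ 0) ⊎ (b ≡ 0)
      cost : φ (suc n) a u + φ (suc n) b v ≤ ψ m q₁ u + φ n r (κ q₁ u) + φ (suc n) (q₂ * m ^ n) v

  pour : ∀ n q₁ r q₂ u v → q₁ < m → r ≤ m ^ n → q₂ ≤ m → u ≤ m → v ≤ m →
    q₁ * m ^ n + r + q₂ * m ^ n ≤ m ^ suc n → Pour n q₁ r q₂ u v
  pour n q₁ r zero u v q₁<m r≤M _ u≤m _ h =
    mkPour (q₁ * m ^ n + r) 0 refl (≤-trans (≤-reflexive (sym (+-identityʳ _))) h) z≤n (inj₂ refl)
      (≤-reflexive (cong (_+ φ (suc n) 0 v) (φ-digits n q₁ r u q₁<m r≤M u≤m)))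
  pour n q₁ r (suc q₂) u v q₁<m r≤M q₂≤m u≤m v≤m h with m≤n⇒m<n∨m≡n q₂≤m
  ... | inj₂ refl with m*n≡0⇒m≡0 q₁ (m ^ n) {{>-nonZero (m^n>0 m n)}} (m+n≡0⇒m≡0 (q₁ * m ^ n) no-room)
                     | m+n≡0⇒n≡0 (q₁ * m ^ n) no-room
    where
    no-room : q₁ * m ^ n + r ≡ 0
    no-room = m+n≤n⇒m≡0 (q₁ * m ^ n + r) (m ^ suc n) h
  ...   | refl | refl = mkPour 0 (m ^ suc n) refl z≤n ≤-refl (inj₁ refl)
          (≤-reflexive (cong (_+ φ (suc n) (m ^ suc n) v)
            (trans (φ-empty (suc n) u) (sym (trans (cong (ψ m 0 u +_) (φ-empty n (κ 0 u))) (ψ-zero m u))))))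
  pour n q₁ r (suc q₂) u v q₁<m r≤M q₂≤m u≤m v≤m h | inj₁ q₂<m with q₁ + suc q₂ <? m
  ... | no q≮m with digits-overflow m q₁ (suc q₂) r (m ^ n) (m^n>0 m n) (≮⇒≥ q≮m) h
  ...   | q≡m , refl = mkPour (m ^ suc n) 0 total ≤-refl z≤n (inj₂ refl)
          (φ-pour-overflow n q₁ (suc q₂) u v 1≤q₁ (s≤s z≤n) q₂<m q≡m u≤m v≤m)
    where
    1≤q₁ : 1 ≤ q₁
    1≤q₁ = +-cancelʳ-≤ (suc q₂) 1 q₁ (≤-trans q₂<m (≤-reflexive (sym q≡m)))
    total : m ^ suc n + 0 ≡ q₁ * m ^ n + 0 + suc q₂ * m ^ n
    total = trans (+-identityʳ _) (trans (cong (_* m ^ n) (sym q≡m)) (distrib q₁ (suc q₂) (m ^ n)))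
      where
      distrib : ∀ a b M → (a + b) * M ≡ a * M + 0 + b * M
      distrib = solve-∀
  pour n zero r (suc q₂) u v q₁<m r≤M q₂≤m u≤m v≤m h | inj₁ q₂<m | yes q<m =
    mkPour 0 (suc q₂ * m ^ n + r) (regroup (suc q₂) (m ^ n) r) z≤n
      (≤-trans (≤-reflexive (trans (+-comm _ r) (sym (+-identityˡ _)))) h) (inj₁ refl)
      (φ-pour-into-empty n (suc q₂) r u v (s≤s z≤n) q₂<m r≤M v≤m)
    where
    regroup : ∀ q M r → 0 + (q * M + r) ≡ 0 * M + r + q * M
    regroup = solve-∀
  pour n (suc q₁) r (suc q₂) u v q₁<m r≤M q₂≤m u≤m v≤m h | inj₁ q₂<m | yes q<m =
    mkPour ((suc q₁ + suc q₂) * m ^ n + r) 0 total (≤-trans (≤-reflexive (trans (sym (+-identityʳ _)) total)) h) z≤n (inj₂ refl)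
      (φ-pour-merge n (suc q₁) (suc q₂) r u v (s≤s z≤n) (s≤s z≤n) q<m r≤M u≤m v≤m)
    where
    regroup : ∀ a b M r → (a + b) * M + r + 0 ≡ a * M + r + b * M
    regroup = solve-∀
    total : (suc q₁ + suc q₂) * m ^ n + r + 0 ≡ suc q₁ * m ^ n + r + suc q₂ * m ^ n
    total = regroup (suc q₁) (suc q₂) (m ^ n) r

  Extreme : ℕ → ℕ → Set
  Extreme n x = (x ≡ 0) ⊎ (x ≡ m ^ n)

  -- α, β are the sizes of two copies of S(n, m), with corner parameters u, v.
  record Exchange (P : ℕ → Set) (n α β u v : ℕ) : Set where
    constructor mkExchange
    field
      a b : ℕ
      total : a + b ≡ α + β
      a≤ : a ≤ m ^ n
      b≤ : b ≤ m ^ n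
      extreme : P a ⊎ P b
      cost : φ n a u + φ n b v ≤ φ n α u + φ n β v

  exchange-swap : ∀ {P n α β u v} → Exchange P n β α v u → Exchange P n α β u v
  exchange-swap {n = n} {α} {β} {u} {v} (mkExchange a b total a≤ b≤ extreme cost) =
    mkExchange b a (trans (+-comm b a) (trans total (+-comm β α))) b≤ a≤ (Data.Sum.swap extreme)
      (≤-trans (≤-reflexive (+-comm (φ n b u) (φ n a v))) (≤-trans cost (≤-reflexive (+-comm (φ n β v) (φ n α u)))))

  ExchangeLemma₀ : ℕ → Set
  ExchangeLemma₀ n = ∀ α β u v → α ≤ m ^ n → β ≤ m ^ n → u ≤ m → v ≤ m → α + β ≤ m ^ n →
    Exchange (_≡ 0) n α β u v

  ExchangeLemma : ℕ → Set
  ExchangeLemma n = ∀ α β u v → α ≤ m ^ n → β ≤ m ^ n → u ≤ m → v ≤ m → Exchange (Extreme n) n α β u v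

  -- When α + β overflows a block, exchange the complements (φ-complement) instead.
  exchange-by-complement : ∀ n → ExchangeLemma₀ n → ExchangeLemma n
  exchange-by-complement n ex α β u v α≤ β≤ u≤m v≤m with α + β ≤? m ^ n
  ... | yes h with ex α β u v α≤ β≤ u≤m v≤m h
  ...   | mkExchange a b total a≤ b≤ extreme cost =
            mkExchange a b total a≤ b≤ (Data.Sum.map inj₁ inj₁ extreme) cost
  exchange-by-complement n ex α β u v α≤ β≤ u≤m v≤m | no h
    with ex (m ^ n ∸ α) (m ^ n ∸ β) (m ∸ u) (m ∸ v) (m∸n≤m _ α) (m∸n≤m _ β) (m∸n≤m m u) (m∸n≤m m v)
            (complement-pair-≤ (m ^ n) α β α≤ β≤ (≰⇒> h))
  ... | mkExchange a b total a≤ b≤ extreme cost =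
    mkExchange (m ^ n ∸ a) (m ^ n ∸ b) (complement-pair-sum (m ^ n) α β a b α≤ β≤ a≤ b≤ total)
      (m∸n≤m _ a) (m∸n≤m _ b) (Data.Sum.map full full extreme) (begin
        φ n (m ^ n ∸ a) u + φ n (m ^ n ∸ b) v
          ≡⟨ cong₂ (λ x y → φ n (m ^ n ∸ a) x + φ n (m ^ n ∸ b) y) (m∸[m∸n]≡n u≤m) (m∸[m∸n]≡n v≤m) ⟨
        φ n (m ^ n ∸ a) (m ∸ (m ∸ u)) + φ n (m ^ n ∸ b) (m ∸ (m ∸ v))
          ≡⟨ cong₂ _+_ (φ-complement n a (m ∸ u) a≤ (m∸n≤m m u)) (φ-complement n b (m ∸ v) b≤ (m∸n≤m m v)) ⟩
        φ n a (m ∸ u) + φ n b (m ∸ v)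
          ≤⟨ cost ⟩
        φ n (m ^ n ∸ α) (m ∸ u) + φ n (m ^ n ∸ β) (m ∸ v)
          ≡⟨ cong₂ _+_ (φ-complement n α u α≤ u≤m) (φ-complement n β v β≤ v≤m) ⟩
        φ n α u + φ n β v ∎)
    where
    open ≤-Reasoning
    full : ∀ {x} → x ≡ 0 → Extreme n (m ^ n ∸ x)
    full x≡0 = inj₂ (cong (m ^ n ∸_) x≡0)

  exchange₀-base : ExchangeLemma₀ 0
  exchange₀-base zero β u v _ β≤ _ _ _ = mkExchange zero β refl z≤n β≤ (inj₁ refl) ≤-refl
  exchange₀-base (suc α) zero u v α≤ _ _ _ _ = mkExchange (suc α) zero refl α≤ z≤n (inj₂ refl) ≤-refl
  exchange₀-base (suc α) (suc β) u v _ _ _ _ (s≤s h) =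
    ⊥-elim (1+n≰n (≤-trans (s≤s z≤n) (≤-trans (≤-reflexive (sym (+-suc α β))) h)))

  extreme-as-blocks : ∀ n q b v → q < m → Extreme n b → v ≤ m →
    Σ ℕ λ Q → (Q ≤ m) × (Q * m ^ n ≡ q * m ^ n + b) × (φ (suc n) (Q * m ^ n) v ≡ ψ m q v + φ n b (κ q v))
  extreme-as-blocks n q b v q<m (inj₁ refl) v≤m =
    q , <⇒≤ q<m , sym (+-identityʳ _) ,
    trans (cong (λ z → φ (suc n) z v) (sym (+-identityʳ _))) (φ-digits n q 0 v q<m z≤n v≤m)
  extreme-as-blocks n q b v q<m (inj₂ refl) v≤m =
    suc q , q<m , +-comm (m ^ n) (q * m ^ n) ,
    trans (cong (λ z → φ (suc n) z v) (+-comm (m ^ n) (q * m ^ n))) (φ-digits n q (m ^ n) v q<m ≤-refl v≤m)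

  -- The recursion of φ splits each side into full blocks and a part block; the exchange one
  -- level down makes one part block extreme, and pouring then empties one side.
  exchange₀-merge : ∀ n α β u v → α ≤ m ^ suc n → β ≤ m ^ suc n → u ≤ m → v ≤ m → α + β ≤ m ^ suc n →
    (e : Exchange (Extreme n) n (partBlock n α) (partBlock n β) (κ (fullBlocks n α) u) (κ (fullBlocks n β) v)) →
    Extreme n (Exchange.b e) → Exchange (_≡ 0) (suc n) α β u v
  exchange₀-merge n α β u v α≤ β≤ u≤m v≤m h (mkExchange a b total a≤ b≤ _ cost) b-extreme
    with digits-bounds n α α≤ | digits-bounds n β β≤
  ... | q₁<m , _ , α≡ | q₂<m , _ , β≡ with extreme-as-blocks n (fullBlocks n β) b v q₂<m b-extreme v≤m
  ... | Q , Q≤m , Q≡ , φQ≡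
    with pour n (fullBlocks n α) a Q u v q₁<m a≤ Q≤m u≤m v≤m (≤-trans (≤-reflexive (sum-regroup _ _ (partBlock n α) (partBlock n β) a b α≡ β≡ total Q≡)) h)
  ... | mkPour a′ b′ total′ a′≤ b′≤ empty cost′ =
    mkExchange a′ b′ (trans total′ (sum-regroup _ _ (partBlock n α) (partBlock n β) a b α≡ β≡ total Q≡)) a′≤ b′≤ empty (begin
      φ (suc n) a′ u + φ (suc n) b′ v
        ≤⟨ cost′ ⟩
      ψ m q₁ u + φ n a (κ q₁ u) + φ (suc n) (Q * m ^ n) v
        ≡⟨ cong (ψ m q₁ u + φ n a (κ q₁ u) +_) φQ≡ ⟩
      ψ m q₁ u + φ n a (κ q₁ u) + (ψ m q₂ v + φ n b (κ q₂ v))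
        ≡⟨ interchange (ψ m q₁ u) _ (ψ m q₂ v) _ ⟩
      ψ m q₁ u + ψ m q₂ v + (φ n a (κ q₁ u) + φ n b (κ q₂ v))
        ≤⟨ +-monoʳ-≤ (ψ m q₁ u + ψ m q₂ v) cost ⟩
      ψ m q₁ u + ψ m q₂ v + (φ n (partBlock n α) (κ q₁ u) + φ n (partBlock n β) (κ q₂ v))
        ≡⟨ interchange (ψ m q₁ u) (ψ m q₂ v) _ _ ⟩
      φ (suc n) α u + φ (suc n) β v ∎)
    where
    open ≤-Reasoning
    q₁ = fullBlocks n α
    q₂ = fullBlocks n β

  exchange₀-step : ∀ n → ExchangeLemma n → ExchangeLemma₀ (suc n)
  exchange₀-step n ex α β u v α≤ β≤ u≤m v≤m h
    with ex (partBlock n α) (partBlock n β) (κ (fullBlocks n α) u) (κ (fullBlocks n β) v)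
            (proj₁ (proj₂ (digits-bounds n α α≤))) (proj₁ (proj₂ (digits-bounds n β β≤)))
            (κ≤m m _ u (fullBlocks<m n α)) (κ≤m m _ v (fullBlocks<m n β))
  ... | e@(mkExchange _ _ _ _ _ (inj₂ b-extreme) _) = exchange₀-merge n α β u v α≤ β≤ u≤m v≤m h e b-extreme
  ... | e@(mkExchange _ _ _ _ _ (inj₁ a-extreme) _) =
    exchange-swap (exchange₀-merge n β α v u β≤ α≤ v≤m u≤m (≤-trans (≤-reflexive (+-comm β α)) h)
      (exchange-swap e) a-extreme)

  exchange : ∀ n → ExchangeLemma n
  exchange zero = exchange-by-complement zero exchange₀-base
  exchange (suc n) = exchange-by-complement (suc n) (exchange₀-step n (exchange n))

  record Normalised (n j : ℕ) (ℓ k : Fin (suc j) → ℕ) : Set where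
    constructor mkNormalised
    field
      ℓ′ : Fin (suc j) → ℕ
      pivot : Fin (suc j)
      total : sum ℓ′ ≡ sum ℓ
      ℓ′≤ : ∀ i → ℓ′ i ≤ m ^ n
      extreme : ∀ i → eqb i pivot ≡ false → Extreme n (ℓ′ i)
      cost : ∑[ i < suc j ] φ n (ℓ′ i) (k i) ≤ ∑[ i < suc j ] φ n (ℓ i) (k i)

  -- Exchange the first size with the pivot of the normalised tail; the new pivot is whichever
  -- of the two did not become extreme.
  normalise : ∀ n j (ℓ k : Fin (suc j) → ℕ) → (∀ i → ℓ i ≤ m ^ n) → (∀ i → k i ≤ m) → Normalised n j ℓ k
  normalise n zero ℓ k ℓ≤ k≤ = mkNormalised ℓ zero refl ℓ≤ (λ { zero () }) ≤-refl
  normalise n (suc j) ℓ k ℓ≤ k≤ with normalise n j (ℓ ∘ suc) (k ∘ suc) (ℓ≤ ∘ suc) (k≤ ∘ suc)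
  ... | mkNormalised ℓ″ p total″ ℓ″≤ extreme″ cost″
    with exchange n (ℓ zero) (ℓ″ p) (k zero) (k (suc p)) (ℓ≤ zero) (ℓ″≤ p) (k≤ zero) (k≤ (suc p))
  ... | mkExchange a b total a≤ b≤ extremeᵃᵇ cost = mkNormalised L (newPivot extremeᵃᵇ) total-L L≤ (L-extreme extremeᵃᵇ) (begin
      ∑[ i < suc (suc j) ] φ n (L i) (k i)
        ≡⟨ ∑-cons-update (suc j) p (λ i x → φ n x (k i)) a b ℓ″ ⟩
      φ n a (k zero) + φ n b (k (suc p)) + rest (λ i x → φ n x (k i))
        ≤⟨ +-monoˡ-≤ _ cost ⟩
      φ n (ℓ zero) (k zero) + φ n (ℓ″ p) (k (suc p)) + rest (λ i x → φ n x (k i))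
        ≡⟨ ∑-cons-pick (suc j) p (λ i x → φ n x (k i)) (ℓ zero) ℓ″ ⟨
      φ n (ℓ zero) (k zero) + ∑[ i < suc j ] φ n (ℓ″ i) (k (suc i))
        ≤⟨ +-monoʳ-≤ (φ n (ℓ zero) (k zero)) cost″ ⟩
      ∑[ i < suc (suc j) ] φ n (ℓ i) (k i) ∎)
    where
    open ≤-Reasoning
    L : Fin (suc (suc j)) → ℕ
    L = cons-update a p b ℓ″
    rest : (Fin (suc (suc j)) → ℕ → ℕ) → ℕ
    rest F = ∑[ i < suc j ] (if eqb i p then 0 else F (suc i) (ℓ″ i))
    total-L : sum L ≡ sum ℓ
    total-L = begin-equality
      sum L                                         ≡⟨ ∑-cons-update (suc j) p (λ _ x → x) a b ℓ″ ⟩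
      a + b + rest (λ _ x → x)                       ≡⟨ cong (_+ rest (λ _ x → x)) total ⟩
      ℓ zero + ℓ″ p + rest (λ _ x → x)               ≡⟨ ∑-cons-pick (suc j) p (λ _ x → x) (ℓ zero) ℓ″ ⟨
      ℓ zero + sum ℓ″                               ≡⟨ cong (ℓ zero +_) total″ ⟩
      sum ℓ                                         ∎
    L≤ : ∀ i → L i ≤ m ^ n
    L≤ zero = a≤
    L≤ (suc i) with eqb i p
    ... | true = b≤
    ... | false = ℓ″≤ i
    newPivot : Extreme n a ⊎ Extreme n b → Fin (suc (suc j))
    newPivot (inj₁ _) = suc p
    newPivot (inj₂ _) = zero
    L-extreme : (e : Extreme n a ⊎ Extreme n b) → ∀ i → eqb i (newPivot e) ≡ false → Extreme n (L i)
    L-extreme (inj₁ a-extreme) zero _ = a-extreme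
    L-extreme (inj₁ _) (suc i) i≢p rewrite i≢p = extreme″ i i≢p
    L-extreme (inj₂ b-extreme) (suc i) _ with eqb i p in i≟p
    ... | true = b-extreme
    ... | false = extreme″ i i≟p

  cutTerm : (e1 ta xab xba : Bool) → ℕ
  cutTerm e1 ta xab xba = (if e1 then 0 else ⟦ ta xor xab ⟧) + ⟦ xab ∧ not xba ⟧

  boundTerm : (e1 e2 e3 ta tb xab xba : Bool) → ℕ
  boundTerm e1 e2 e3 ta tb xab xba =
    (if e1 then 0 else (if e2 then 0 else ⟦ ta ∧ not tb ⟧))
    + (if e1 then 0 else (if e3 then ⟦ ta xor xab ⟧ else 0))
    + (if e1 then 0 else (if e2 then ⟦ ta xor xba ⟧ else 0))

  boundTerm≤cutTerm : ∀ (e1 e2 ta tb xab xba : Bool) → (e1 ∧ e2) ≡ false →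
    boundTerm e1 e2 false ta tb xab xba + boundTerm e2 e1 false tb ta xba xab ≤ cutTerm e1 ta xab xba + cutTerm e2 tb xba xab
  boundTerm≤cutTerm e1 e2 ta tb xab xba e1∧e2≡false =
    ≤ᵇ⇒≤ _ _ (T-∨-elim (subst T e1∧e2≡false) (check-sound 6 formula tt e1 e2 ta tb xab xba))
    where
    formula : BoolFormula 6
    formula e1 e2 ta tb xab xba = (e1 ∧ e2) ∨
      (boundTerm e1 e2 false ta tb xab xba + boundTerm e2 e1 false tb ta xba xab ≤ᵇ cutTerm e1 ta xab xba + cutTerm e2 tb xba xab)

  boundTerm≤cutTerm-diagonal : ∀ (e1 ta x : Bool) → boundTerm e1 e1 true ta ta x x + boundTerm e1 e1 true ta ta x x ≤ cutTerm e1 ta x x + cutTerm e1 ta x x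
  boundTerm≤cutTerm-diagonal e1 ta x = ≤ᵇ⇒≤ _ _ (check-sound 3 formula tt e1 ta x)
    where
    formula : BoolFormula 3
    formula e1 ta x = boundTerm e1 e1 true ta ta x x + boundTerm e1 e1 true ta ta x x ≤ᵇ cutTerm e1 ta x x + cutTerm e1 ta x x

  bridgeCut : (Fin m → Fin m → Bool) → ℕ
  bridgeCut x = ∑[ a < m ] ∑[ b < m ] ⟦ x a b ∧ not (x b a) ⟧

  -- p is the partial copy, t a says copy a is full, x a b says the corner bⁿ of copy a is in S.
  -- E a b is what S pays at the ordered pair (a, b): a corner mismatch inside a non-partial copy
  -- and the bridge cut from a's side; R a b is what the top-level term of φ needs there.
  module BridgeCount (p : Fin m) (t : Fin m → Bool) (x : Fin m → Fin m → Bool) where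

    E : Fin m → Fin m → ℕ
    E a b = cutTerm (eqb a p) (t a) (x a b) (x b a)

    R : Fin m → Fin m → ℕ
    R a b = boundTerm (eqb a p) (eqb b p) (eqb a b) (t a) (t b) (x a b) (x b a)

    boundTerms≤cutTerms : ∀ a b → R a b + R b a ≤ E a b + E b a
    boundTerms≤cutTerms a b with eqb a b in e3
    ... | true with eqb-true a b e3
    ...   | refl rewrite eqb-refl a = boundTerm≤cutTerm-diagonal (eqb a p) (t a) (x a a)
    boundTerms≤cutTerms a b | false rewrite trans (eqb-sym b a) e3 = boundTerm≤cutTerm (eqb a p) (eqb b p) (t a) (t b) (x a b) (x b a) (not-both-pivot (eqb a p) (eqb b p) refl refl)
      where
      not-both-pivot : ∀ u v → eqb a p ≡ u → eqb b p ≡ v → (u ∧ v) ≡ false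
      not-both-pivot true true e1 e2
        with () ← trans (sym e3) (trans (cong (eqb a) (trans (eqb-true b p e2) (sym (eqb-true a p e1)))) (eqb-refl a))
      not-both-pivot true false e1 e2 = refl
      not-both-pivot false v e1 e2 = refl

    ΣΣ : (Fin m → Fin m → ℕ) → ℕ
    ΣΣ g = ∑[ a < m ] ∑[ b < m ] g a b


    mismatches : ℕ
    mismatches = ∑[ a < m ] (if eqb a p then 0 else ∑[ b < m ] ⟦ t a xor x a b ⟧)

    ∑∑boundTerm≤∑∑cutTerm : ΣΣ R ≤ ΣΣ E
    ∑∑boundTerm≤∑∑cutTerm = *-cancelˡ-≤ 2 (begin
      2 * ΣΣ R ≡⟨ sym (∑∑-symmetrize m R) ⟩
      ΣΣ (λ a b → R a b + R b a) ≤⟨ ∑-mono-≤ m (λ a → ∑-mono-≤ m (λ b → boundTerms≤cutTerms a b)) ⟩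
      ΣΣ (λ a b → E a b + E b a) ≡⟨ ∑∑-symmetrize m E ⟩
      2 * ΣΣ E ∎)
      where open ≤-Reasoning

    ΣΣ-+ : ∀ (g h : Fin m → Fin m → ℕ) → ΣΣ (λ a b → g a b + h a b) ≡ ΣΣ g + ΣΣ h
    ΣΣ-+ g h = trans (sum-cong-≗ (λ a → ∑-distrib-+ (g a) (h a))) (∑-distrib-+ (λ a → sum (g a)) (λ a → sum (h a)))

    ∑∑cutTerm≡ : ΣΣ E ≡ mismatches + bridgeCut x
    ∑∑cutTerm≡ = trans (ΣΣ-+ (λ a b → if eqb a p then 0 else ⟦ t a xor x a b ⟧) (λ a b → ⟦ x a b ∧ not (x b a) ⟧))
                (cong (_+ bridgeCut x) (sum-cong-≗ (λ a → ∑-if0 m (eqb a p) (λ b → ⟦ t a xor x a b ⟧))))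

    f e K′ k′ : ℕ
    f = ∑[ a < m ] (if eqb a p then 0 else ⟦ t a ⟧)
    e = ∑[ a < m ] (if eqb a p then 0 else ⟦ not (t a) ⟧)
    K′ = ∑[ a < m ] (if eqb a p then 0 else ⟦ x a a ⟧)
    k′ = ∑[ a < m ] (if eqb a p then 0 else ⟦ x p a ⟧)

    fullEmptyPairs≡ : ΣΣ (λ a b → if eqb a p then 0 else (if eqb b p then 0 else ⟦ t a ∧ not (t b) ⟧)) ≡ f * e
    fullEmptyPairs≡ = trans (sum-cong-≗ pa) (trans (sum-cong-≗ (λ a → *-comm (if eqb a p then 0 else ⟦ t a ⟧) e)) (trans (sym (*-distribˡ-sum e (λ a → if eqb a p then 0 else ⟦ t a ⟧))) (*-comm e f)))
      where
      pa : ∀ a → ∑[ b < m ] (if eqb a p then 0 else (if eqb b p then 0 else ⟦ t a ∧ not (t b) ⟧)) ≡ (if eqb a p then 0 else ⟦ t a ⟧) * e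
      pa a with eqb a p | t a
      ... | true | _ = sum-replicate-zero m
      ... | false | true = sym (+-identityʳ e)
      ... | false | false = trans (sum-cong-≗ (λ b → z b)) (sum-replicate-zero m)
        where
        z : ∀ b → (if eqb b p then 0 else 0) ≡ 0
        z b with eqb b p
        ... | true = refl
        ... | false = refl

    diagonal≡ : ΣΣ (λ a b → if eqb a p then 0 else (if eqb a b then ⟦ t a xor x a b ⟧ else 0)) ≡ ∑[ a < m ] (if eqb a p then 0 else ⟦ t a xor x a a ⟧)
    diagonal≡ = sum-cong-≗ pa
      where
      pa : ∀ a → ∑[ b < m ] (if eqb a p then 0 else (if eqb a b then ⟦ t a xor x a b ⟧ else 0)) ≡ (if eqb a p then 0 else ⟦ t a xor x a a ⟧)
      pa a with eqb a p
      ... | true = sum-replicate-zero m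
      ... | false = trans (sum-cong-≗ (λ b → cong (λ w → if w then ⟦ t a xor x a b ⟧ else 0) (eqb-sym a b))) (∑-pick m a (λ b → ⟦ t a xor x a b ⟧))

    pivotColumn≡ : ΣΣ (λ a b → if eqb a p then 0 else (if eqb b p then ⟦ t a xor x b a ⟧ else 0)) ≡ ∑[ a < m ] (if eqb a p then 0 else ⟦ t a xor x p a ⟧)
    pivotColumn≡ = sum-cong-≗ pa
      where
      pa : ∀ a → ∑[ b < m ] (if eqb a p then 0 else (if eqb b p then ⟦ t a xor x b a ⟧ else 0)) ≡ (if eqb a p then 0 else ⟦ t a xor x p a ⟧)
      pa a with eqb a p
      ... | true = sum-replicate-zero m
      ... | false = ∑-pick m p (λ b → ⟦ t a xor x b a ⟧)

    ∑∑boundTerm≡ : ΣΣ R ≡ f * e + ∑[ a < m ] (if eqb a p then 0 else ⟦ t a xor x a a ⟧) + ∑[ a < m ] (if eqb a p then 0 else ⟦ t a xor x p a ⟧)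
    ∑∑boundTerm≡ = trans (ΣΣ-+ (λ a b → R1 a b + R2 a b) R3) (cong₂ _+_ (trans (ΣΣ-+ R1 R2) (cong₂ _+_ fullEmptyPairs≡ diagonal≡)) pivotColumn≡)
      where
      R1 R2 R3 : Fin m → Fin m → ℕ
      R1 a b = if eqb a p then 0 else (if eqb b p then 0 else ⟦ t a ∧ not (t b) ⟧)
      R2 a b = if eqb a p then 0 else (if eqb a b then ⟦ t a xor x a b ⟧ else 0)
      R3 a b = if eqb a p then 0 else (if eqb b p then ⟦ t a xor x b a ⟧ else 0)

    ∣if-⟦⟧-if-⟦⟧∣≤ : ∀ (w y s : Bool) → ∣ (if w then 0 else ⟦ y ⟧) - (if w then 0 else ⟦ s ⟧) ∣ ≤ (if w then 0 else ⟦ s xor y ⟧)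
    ∣if-⟦⟧-if-⟦⟧∣≤ true y s = z≤n
    ∣if-⟦⟧-if-⟦⟧∣≤ false true true = z≤n
    ∣if-⟦⟧-if-⟦⟧∣≤ false true false = ≤-refl
    ∣if-⟦⟧-if-⟦⟧∣≤ false false true = ≤-refl
    ∣if-⟦⟧-if-⟦⟧∣≤ false false false = z≤n

    ∣K′-f∣≤ : ∣ K′ - f ∣ ≤ ∑[ a < m ] (if eqb a p then 0 else ⟦ t a xor x a a ⟧)
    ∣K′-f∣≤ = ≤-trans (∣∑-∑∣≤∑∣-∣ m (λ a → if eqb a p then 0 else ⟦ x a a ⟧) (λ a → if eqb a p then 0 else ⟦ t a ⟧)) (∑-mono-≤ m (λ a → ∣if-⟦⟧-if-⟦⟧∣≤ (eqb a p) (x a a) (t a)))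
    ∣k′-f∣≤ : ∣ k′ - f ∣ ≤ ∑[ a < m ] (if eqb a p then 0 else ⟦ t a xor x p a ⟧)
    ∣k′-f∣≤ = ≤-trans (∣∑-∑∣≤∑∣-∣ m (λ a → if eqb a p then 0 else ⟦ x p a ⟧) (λ a → if eqb a p then 0 else ⟦ t a ⟧)) (∑-mono-≤ m (λ a → ∣if-⟦⟧-if-⟦⟧∣≤ (eqb a p) (x p a) (t a)))

    e+f≡m₀ : e + f ≡ m₀
    e+f≡m₀ = +-cancelˡ-≡ 1 _ _ (trans (cong (1 +_) (trans (sym (∑-distrib-+ (λ a → if eqb a p then 0 else ⟦ not (t a) ⟧) (λ a → if eqb a p then 0 else ⟦ t a ⟧))) (sum-cong-≗ pw1)))
                                  (trans (sym (∑-split m p (λ _ → 1))) (trans (∑-const m 1) (*-identityʳ m))))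
      where
      pw1 : ∀ a → (if eqb a p then 0 else ⟦ not (t a) ⟧) + (if eqb a p then 0 else ⟦ t a ⟧) ≡ (if eqb a p then 0 else 1)
      pw1 a with eqb a p | t a
      ... | true | _ = refl
      ... | false | true = refl
      ... | false | false = refl

    diagonal-split : ∑[ a < m ] ⟦ x a a ⟧ ≡ ⟦ x p p ⟧ + K′
    diagonal-split = ∑-split m p (λ a → ⟦ x a a ⟧)
    pivotRow-split : ∑[ b < m ] ⟦ x p b ⟧ ≡ ⟦ x p p ⟧ + k′
    pivotRow-split = ∑-split m p (λ b → ⟦ x p b ⟧)

    bridge-bound : ψ m f (∑[ a < m ] ⟦ x a a ⟧) + ∣ κ f (∑[ a < m ] ⟦ x a a ⟧) - ∑[ b < m ] ⟦ x p b ⟧ ∣ ≤ mismatches + bridgeCut x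
    bridge-bound rewrite diagonal-split | pivotRow-split = begin
      blockPairs m f + ∣ κ f (xp + K′) - (xp + K′) ∣ + ∣ κ f (xp + K′) - (xp + k′) ∣
        ≡⟨ +-assoc (blockPairs m f) _ _ ⟩
      blockPairs m f + (∣ κ f (xp + K′) - (xp + K′) ∣ + ∣ κ f (xp + K′) - (xp + k′) ∣)
        ≡⟨ cong (λ z → blockPairs m f + (∣ κ f (xp + K′) - (xp + K′) ∣ + z)) (∣-∣-comm (κ f (xp + K′)) (xp + k′)) ⟩
      blockPairs m f + (∣ κ f (xp + K′) - (xp + K′) ∣ + ∣ (xp + k′) - κ f (xp + K′) ∣)
        ≤⟨ +-monoʳ-≤ (blockPairs m f) (κ-bridge f K′ k′ (x p p)) ⟩
      blockPairs m f + (∣ K′ - f ∣ + ∣ k′ - f ∣)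
        ≤⟨ +-monoʳ-≤ (blockPairs m f) (+-mono-≤ ∣K′-f∣≤ ∣k′-f∣≤) ⟩
      blockPairs m f + (∑[ a < m ] (if eqb a p then 0 else ⟦ t a xor x a a ⟧) + ∑[ a < m ] (if eqb a p then 0 else ⟦ t a xor x p a ⟧))
        ≡⟨ sym (+-assoc (blockPairs m f) _ _) ⟩
      blockPairs m f + ∑[ a < m ] (if eqb a p then 0 else ⟦ t a xor x a a ⟧) + ∑[ a < m ] (if eqb a p then 0 else ⟦ t a xor x p a ⟧)
        ≡⟨ cong (λ z → z + ∑[ a < m ] (if eqb a p then 0 else ⟦ t a xor x a a ⟧) + ∑[ a < m ] (if eqb a p then 0 else ⟦ t a xor x p a ⟧)) pairs≡f*e ⟩
      f * e + ∑[ a < m ] (if eqb a p then 0 else ⟦ t a xor x a a ⟧) + ∑[ a < m ] (if eqb a p then 0 else ⟦ t a xor x p a ⟧)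
        ≡⟨ sym ∑∑boundTerm≡ ⟩
      ΣΣ R
        ≤⟨ ∑∑boundTerm≤∑∑cutTerm ⟩
      ΣΣ E
        ≡⟨ ∑∑cutTerm≡ ⟩
      mismatches + bridgeCut x ∎
      where
      open ≤-Reasoning
      xp = ⟦ x p p ⟧
      pairs≡f*e : blockPairs m f ≡ f * e
      pairs≡f*e = cong (f *_) (trans (cong (_∸ f) (sym e+f≡m₀)) (m+n∸n≡m e f))

  m^n≢ᵇ0 : ∀ n → (m ^ n ≡ᵇ 0) ≡ false
  m^n≢ᵇ0 n with m ^ n | m^n>0 m n
  ... | suc _ | _ = refl

  φ-step-bound : ∀ n (ℓ : Fin m → ℕ) (x : Fin m → Fin m → Bool) → (∀ a → ℓ a ≤ m ^ n) →
    φ (suc n) (sum ℓ) (∑[ a < m ] ⟦ x a a ⟧) ≤ ∑[ a < m ] φ n (ℓ a) (∑[ b < m ] ⟦ x a b ⟧) + bridgeCut x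
  φ-step-bound n ℓ x ℓ≤ with normalise n m₀ ℓ k ℓ≤ k≤
    where
    k : Fin m → ℕ
    k a = ∑[ b < m ] ⟦ x a b ⟧
    k≤ : ∀ a → k a ≤ m
    k≤ a = ∑⟦⟧≤ m (x a)
  ... | mkNormalised ℓ′ p total ℓ′≤ extreme cost = begin
      φ (suc n) (sum ℓ) K
        ≡⟨ cong (λ z → φ (suc n) z K) (sym total) ⟩
      φ (suc n) (sum ℓ′) K
        ≡⟨ cong (λ z → φ (suc n) z K) ∑ℓ′ ⟩
      φ (suc n) (f * m ^ n + ℓ′ p) K
        ≡⟨ φ-digits n f (ℓ′ p) K f<m (ℓ′≤ p) K≤ ⟩
      ψ m f K + φ n (ℓ′ p) (κ f K)
        ≤⟨ +-monoʳ-≤ (ψ m f K) (φ-lipschitz n (ℓ′ p) (κ f K) (k p)) ⟩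
      ψ m f K + (φ n (ℓ′ p) (k p) + ∣ κ f K - k p ∣)
        ≡⟨ shuffle (ψ m f K) (φ n (ℓ′ p) (k p)) ∣ κ f K - k p ∣ ⟩
      φ n (ℓ′ p) (k p) + (ψ m f K + ∣ κ f K - k p ∣)
        ≤⟨ +-monoʳ-≤ (φ n (ℓ′ p) (k p)) (BridgeCount.bridge-bound p t x) ⟩
      φ n (ℓ′ p) (k p) + (BridgeCount.mismatches p t x + bridgeCut x)
        ≡⟨ cong (λ z → φ n (ℓ′ p) (k p) + (z + bridgeCut x)) (sum-cong-≗ mismatch≡φ) ⟩
      φ n (ℓ′ p) (k p) + (∑[ a < m ] (if eqb a p then 0 else φ n (ℓ′ a) (k a)) + bridgeCut x)
        ≡⟨ sym (+-assoc (φ n (ℓ′ p) (k p)) _ (bridgeCut x)) ⟩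
      φ n (ℓ′ p) (k p) + ∑[ a < m ] (if eqb a p then 0 else φ n (ℓ′ a) (k a)) + bridgeCut x
        ≡⟨ cong (_+ bridgeCut x) (sym (∑-split m p (λ a → φ n (ℓ′ a) (k a)))) ⟩
      ∑[ a < m ] φ n (ℓ′ a) (k a) + bridgeCut x
        ≤⟨ +-monoˡ-≤ (bridgeCut x) cost ⟩
      ∑[ a < m ] φ n (ℓ a) (k a) + bridgeCut x ∎
    where
    open ≤-Reasoning
    k : Fin m → ℕ
    k a = ∑[ b < m ] ⟦ x a b ⟧
    K = ∑[ a < m ] ⟦ x a a ⟧
    K≤ : K ≤ m
    K≤ = ∑⟦⟧≤ m (λ a → x a a)
    t : Fin m → Bool
    t a = not (ℓ′ a ≡ᵇ 0)
    f = BridgeCount.f p t x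
    f<m : f < m
    f<m = s≤s (≤-trans (m≤n+m f (BridgeCount.e p t x)) (≤-reflexive (BridgeCount.e+f≡m₀ p t x)))
    shuffle : ∀ a b c → a + (b + c) ≡ b + (a + c)
    shuffle = solve-∀
    ℓ′-extreme-value : ∀ a → eqb a p ≡ false → ℓ′ a ≡ ⟦ t a ⟧ * m ^ n
    ℓ′-extreme-value a e with extreme a e
    ... | inj₁ z rewrite z = refl
    ... | inj₂ z rewrite z | m^n≢ᵇ0 n = sym (+-identityʳ (m ^ n))
    ∑ℓ′ : sum ℓ′ ≡ f * m ^ n + ℓ′ p
    ∑ℓ′ = trans (∑-split m p ℓ′) (trans (+-comm (ℓ′ p) _) (cong (_+ ℓ′ p) (trans (sum-cong-≗ pointwise) (trans (sym (*-distribˡ-sum (m ^ n) (λ a → if eqb a p then 0 else ⟦ t a ⟧))) (*-comm (m ^ n) f)))))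
      where
      pointwise : ∀ a → (if eqb a p then 0 else ℓ′ a) ≡ m ^ n * (if eqb a p then 0 else ⟦ t a ⟧)
      pointwise a with eqb a p in e
      ... | true = sym (*-zeroʳ (m ^ n))
      ... | false = trans (ℓ′-extreme-value a e) (*-comm ⟦ t a ⟧ (m ^ n))
    mismatch≡φ : ∀ a → (if eqb a p then 0 else ∑[ b < m ] ⟦ t a xor x a b ⟧) ≡ (if eqb a p then 0 else φ n (ℓ′ a) (k a))
    mismatch≡φ a with eqb a p in e
    ... | true = refl
    ... | false with extreme a e
    ...   | inj₁ z rewrite z = sym (φ-empty n (k a))
    ...   | inj₂ z rewrite z | m^n≢ᵇ0 n | φ-full n (k a) (∑⟦⟧≤ m (x a)) =
            sym (trans (cong (_∸ k a) (sym (∑⟦not⟧+∑⟦⟧ m (x a)))) (m+n∸n≡m _ (k a)))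

  Vx : ℕ → Set
  Vx n = Vertex n m

  ∑ᵛ : ∀ n → (Vx n → ℕ) → ℕ
  ∑ᵛ zero f = f []
  ∑ᵛ (suc n) f = ∑[ a < m ] ∑ᵛ n (λ u → f (a ∷ u))

  sum-allVertices : ∀ n (g : Vx n → ℕ) → sumˡ (map g (allVertices n m)) ≡ ∑ᵛ n g
  sum-allVertices zero g = +-identityʳ (g [])
  sum-allVertices (suc n) g =
    trans (sumˡ-map-concatMap g (λ a → map (a ∷_) (allVertices n m)) (allFin m))
      (trans (cong sumˡ (map-cong (λ a → trans (cong sumˡ (sym (map-∘ (allVertices n m)))) (sum-allVertices n (λ u → g (a ∷ u)))) (allFin m)))
        (sumˡ-map-allFin m (λ a → ∑ᵛ n (λ u → g (a ∷ u)))))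

  cardᵛ : ∀ {n} → VSubset n m → ℕ
  cardᵛ {n} S = ∑ᵛ n (λ v → ⟦ S v ⟧)

  innerᵛ : ∀ {n} → VSubset n m → ℕ
  innerᵛ {n} S = ∑ᵛ n (λ u → ∑ᵛ n (λ v → ⟦ S u ∧ (not (S v) ∧ adj u v) ⟧))

  cornerCount : ∀ {n} → VSubset n m → ℕ
  cornerCount {n} S = ∑[ a < m ] ⟦ S (replicate n a) ⟧

  card≡cardᵛ : ∀ n (S : VSubset n m) → card S ≡ cardᵛ S
  card≡cardᵛ n S = trans (count≡sumˡ S (allVertices n m)) (sum-allVertices n (λ v → ⟦ S v ⟧))

  innerCut≡innerᵛ : ∀ n (S : VSubset n m) → innerCut S ≡ innerᵛ S
  innerCut≡innerᵛ n S =
    trans (count≡sumˡ _ (cartesianProduct (allVertices n m) (allVertices n m)))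
      (trans (sumˡ-map-cartesianProduct _ (allVertices n m) (allVertices n m))
        (trans (cong sumˡ (map-cong (λ u → sum-allVertices n (λ v → ⟦ S u ∧ (not (S v) ∧ adj u v) ⟧)) (allVertices n m)))
          (sum-allVertices n (λ u → ∑ᵛ n (λ v → ⟦ S u ∧ (not (S v) ∧ adj u v) ⟧)))))

  exteriorCut≡∑ : ∀ s t n (S : VSubset n m) → exteriorCut s t S ≡
    ∑[ i < m ] ⟦ ((toℕ i <ᵇ s) ∧ not (S (corner n i))) ∨ (((s + t) ≤ᵇ toℕ i) ∧ S (corner n i)) ⟧
  exteriorCut≡∑ s t n S = trans (count≡sumˡ Q (allFin m)) (sumˡ-map-allFin m (λ i → ⟦ Q i ⟧))
    where
    Q : Fin m → Bool
    Q i = ((toℕ i <ᵇ s) ∧ not (S (corner n i))) ∨ (((s + t) ≤ᵇ toℕ i) ∧ S (corner n i))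

  ∑ᵛ-cong : ∀ n {f g : Vx n → ℕ} → (∀ v → f v ≡ g v) → ∑ᵛ n f ≡ ∑ᵛ n g
  ∑ᵛ-cong zero e = e []
  ∑ᵛ-cong (suc n) e = sum-cong-≗ (λ a → ∑ᵛ-cong n (λ u → e (a ∷ u)))

  ∑ᵛ-+ : ∀ n (f g : Vx n → ℕ) → ∑ᵛ n (λ v → f v + g v) ≡ ∑ᵛ n f + ∑ᵛ n g
  ∑ᵛ-+ zero f g = refl
  ∑ᵛ-+ (suc n) f g = trans (sum-cong-≗ (λ a → ∑ᵛ-+ n (λ u → f (a ∷ u)) (λ u → g (a ∷ u))))
                           (∑-distrib-+ (λ a → ∑ᵛ n (λ u → f (a ∷ u))) (λ a → ∑ᵛ n (λ u → g (a ∷ u))))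

  ∑ᵛ-zero : ∀ n → ∑ᵛ n (λ _ → 0) ≡ 0
  ∑ᵛ-zero zero = refl
  ∑ᵛ-zero (suc n) = trans (sum-cong-≗ {m} (λ a → ∑ᵛ-zero n)) (sum-replicate-zero m)

  ∑ᵛ-const : ∀ n c → ∑ᵛ n (λ _ → c) ≡ m ^ n * c
  ∑ᵛ-const zero c = sym (+-identityʳ c)
  ∑ᵛ-const (suc n) c = trans (sum-cong-≗ {m} (λ a → ∑ᵛ-const n c)) (trans (∑-const m (m ^ n * c)) (sym (*-assoc m (m ^ n) c)))

  ∑ᵛ-if : ∀ n (e : Bool) (g : Vx n → ℕ) → ∑ᵛ n (λ v → if e then g v else 0) ≡ (if e then ∑ᵛ n g else 0)
  ∑ᵛ-if n true g = refl
  ∑ᵛ-if n false g = ∑ᵛ-zero n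

  ∑ᵛ-if0 : ∀ n (e : Bool) (g : Vx n → ℕ) → ∑ᵛ n (λ v → if e then 0 else g v) ≡ (if e then 0 else ∑ᵛ n g)
  ∑ᵛ-if0 n true g = ∑ᵛ-zero n
  ∑ᵛ-if0 n false g = refl

  ∑ᵛ-∑-comm : ∀ n (f : Vx n → Fin m → ℕ) → ∑ᵛ n (λ u → ∑[ b < m ] f u b) ≡ ∑[ b < m ] ∑ᵛ n (λ u → f u b)
  ∑ᵛ-∑-comm zero f = refl
  ∑ᵛ-∑-comm (suc n) f =
    trans (sum-cong-≗ (λ a → ∑ᵛ-∑-comm n (λ u b → f (a ∷ u) b)))
          (∑-comm (λ a b → ∑ᵛ n (λ u → f (a ∷ u) b)))

  ∑ᵛ⟦⟧≤ : ∀ n (P : Vx n → Bool) → ∑ᵛ n (λ v → ⟦ P v ⟧) ≤ m ^ n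
  ∑ᵛ⟦⟧≤ zero P = ⟦⟧≤1 (P [])
  ∑ᵛ⟦⟧≤ (suc n) P = ∑-bound m _ (m ^ n) (λ a → ∑ᵛ⟦⟧≤ n (λ u → P (a ∷ u)))

  ==-eqb : ∀ {j} (a b : Fin j) → (a == b) ≡ eqb a b
  ==-eqb zero zero = refl
  ==-eqb zero (suc b) = refl
  ==-eqb (suc a) zero = refl
  ==-eqb (suc a) (suc b) with a ≟ b
  ... | yes refl = sym (eqb-refl a)
  ... | no ne = sym (eqb-false a b ne)
    where
    eqb-false : ∀ {j} (a b : Fin j) → ¬ a ≡ b → eqb a b ≡ false
    eqb-false a b ne with eqb a b in e
    ... | true = ⊥-elim (ne (eqb-true a b e))
    ... | false = refl

  ∑ᵛ-pick : ∀ n (a : Fin m) (g : Vx n → ℕ) → ∑ᵛ n (λ v → if allEq a v then g v else 0) ≡ g (replicate n a)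
  ∑ᵛ-pick zero a g = refl
  ∑ᵛ-pick (suc n) a g =
    trans (sum-cong-≗ pointwise) (∑-pick m a (λ c → g (c ∷ replicate n a)))
    where
    pointwise : ∀ c → ∑ᵛ n (λ v → if (c == a) ∧ allEq a v then g (c ∷ v) else 0) ≡ (if eqb c a then g (c ∷ replicate n a) else 0)
    pointwise c rewrite ==-eqb c a with eqb c a in e
    ... | true rewrite eqb-true c a e = ∑ᵛ-pick n a (λ v → g (a ∷ v))
    ... | false = ∑ᵛ-zero n

  ⟦∧∧⟧≡if : ∀ X Y A B → ⟦ X ∧ (Y ∧ (A ∧ B)) ⟧ ≡ (if A then (if B then ⟦ X ∧ Y ⟧ else 0) else 0)
  ⟦∧∧⟧≡if X Y true true = cong ⟦_⟧ (cong (X ∧_) (∧-identityʳ Y))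
  ⟦∧∧⟧≡if true true true false = refl
  ⟦∧∧⟧≡if true false true false = refl
  ⟦∧∧⟧≡if false Y true false = refl
  ⟦∧∧⟧≡if true true false B = refl
  ⟦∧∧⟧≡if true false false B = refl
  ⟦∧∧⟧≡if false Y false B = refl

  adj-cons-split : ∀ {n} (T : VSubset (suc n) m) a b u v →
    ⟦ T (a ∷ u) ∧ (not (T (b ∷ v)) ∧ adj (a ∷ u) (b ∷ v)) ⟧ ≡
    (if eqb a b then ⟦ T (a ∷ u) ∧ (not (T (b ∷ v)) ∧ adj u v) ⟧ else 0)
    + (if eqb a b then 0 else (if allEq b u then (if allEq a v then ⟦ T (a ∷ u) ∧ not (T (b ∷ v)) ⟧ else 0) else 0))
  adj-cons-split T a b u v rewrite ==-eqb a b with eqb a b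
  ... | true = sym (+-identityʳ _)
  ... | false = ⟦∧∧⟧≡if (T (a ∷ u)) (not (T (b ∷ v))) (allEq b u) (allEq a v)

  innerᵛ-decomposition : ∀ n (T : VSubset (suc n) m) →
    innerᵛ T ≡ ∑[ a < m ] innerᵛ {n} (λ w → T (a ∷ w)) + bridgeCut (λ a b → T (a ∷ replicate n b))
  innerᵛ-decomposition n T = begin
    ∑[ a < m ] ∑ᵛ n (λ u → ∑[ b < m ] ∑ᵛ n (λ v → F a u b v))
      ≡⟨ sum-cong-≗ (λ a → ∑ᵛ-cong n (λ u → sum-cong-≗ (λ b → trans (∑ᵛ-cong n (λ v → adj-cons-split T a b u v)) (∑ᵛ-+ n (A a u b) (B a u b))))) ⟩
    ∑[ a < m ] ∑ᵛ n (λ u → ∑[ b < m ] (∑ᵛ n (λ v → A a u b v) + ∑ᵛ n (λ v → B a u b v)))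
      ≡⟨ sum-cong-≗ (λ a → trans (∑ᵛ-cong n (λ u → ∑-distrib-+ (λ b → ∑ᵛ n (A a u b)) (λ b → ∑ᵛ n (B a u b)))) (∑ᵛ-+ n (λ u → ∑[ b < m ] ∑ᵛ n (A a u b)) (λ u → ∑[ b < m ] ∑ᵛ n (B a u b)))) ⟩
    ∑[ a < m ] (∑ᵛ n (λ u → ∑[ b < m ] ∑ᵛ n (λ v → A a u b v)) + ∑ᵛ n (λ u → ∑[ b < m ] ∑ᵛ n (λ v → B a u b v)))
      ≡⟨ ∑-distrib-+ (λ a → ∑ᵛ n (λ u → ∑[ b < m ] ∑ᵛ n (A a u b))) (λ a → ∑ᵛ n (λ u → ∑[ b < m ] ∑ᵛ n (B a u b))) ⟩
    ∑[ a < m ] ∑ᵛ n (λ u → ∑[ b < m ] ∑ᵛ n (λ v → A a u b v)) + ∑[ a < m ] ∑ᵛ n (λ u → ∑[ b < m ] ∑ᵛ n (λ v → B a u b v))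
      ≡⟨ cong₂ _+_ (sum-cong-≗ sameFirstLetter) (sum-cong-≗ differentFirstLetters) ⟩
    ∑[ a < m ] innerᵛ {n} (λ w → T (a ∷ w)) + bridgeCut x ∎
    where
    open ≡-Reasoning
    x : Fin m → Fin m → Bool
    x a b = T (a ∷ replicate n b)
    F : Fin m → Vx n → Fin m → Vx n → ℕ
    F a u b v = ⟦ T (a ∷ u) ∧ (not (T (b ∷ v)) ∧ adj (a ∷ u) (b ∷ v)) ⟧
    A : Fin m → Vx n → Fin m → Vx n → ℕ
    A a u b v = if eqb a b then ⟦ T (a ∷ u) ∧ (not (T (b ∷ v)) ∧ adj u v) ⟧ else 0
    B : Fin m → Vx n → Fin m → Vx n → ℕ
    B a u b v = if eqb a b then 0 else (if allEq b u then (if allEq a v then ⟦ T (a ∷ u) ∧ not (T (b ∷ v)) ⟧ else 0) else 0)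
    sameFirstLetter : ∀ a → ∑ᵛ n (λ u → ∑[ b < m ] ∑ᵛ n (λ v → A a u b v)) ≡ innerᵛ {n} (λ w → T (a ∷ w))
    sameFirstLetter a = ∑ᵛ-cong n (λ u → trans (sum-cong-≗ (λ b → trans (∑ᵛ-if n (eqb a b) (λ v → ⟦ T (a ∷ u) ∧ (not (T (b ∷ v)) ∧ adj u v) ⟧)) (cong (λ e → if e then ∑ᵛ n (λ v → ⟦ T (a ∷ u) ∧ (not (T (b ∷ v)) ∧ adj u v) ⟧) else 0) (eqb-sym a b))))
                                     (∑-pick m a (λ b → ∑ᵛ n (λ v → ⟦ T (a ∷ u) ∧ (not (T (b ∷ v)) ∧ adj u v) ⟧))))
    differentFirstLetters : ∀ a → ∑ᵛ n (λ u → ∑[ b < m ] ∑ᵛ n (λ v → B a u b v)) ≡ ∑[ b < m ] ⟦ x a b ∧ not (x b a) ⟧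
    differentFirstLetters a = begin
      ∑ᵛ n (λ u → ∑[ b < m ] ∑ᵛ n (λ v → B a u b v))
        ≡⟨ ∑ᵛ-cong n (λ u → sum-cong-≗ (λ b → cornerTerm u b)) ⟩
      ∑ᵛ n (λ u → ∑[ b < m ] (if eqb a b then 0 else (if allEq b u then ⟦ T (a ∷ u) ∧ not (T (b ∷ replicate n a)) ⟧ else 0)))
        ≡⟨ ∑ᵛ-∑-comm n (λ u b → if eqb a b then 0 else (if allEq b u then ⟦ T (a ∷ u) ∧ not (T (b ∷ replicate n a)) ⟧ else 0)) ⟩
      ∑[ b < m ] ∑ᵛ n (λ u → if eqb a b then 0 else (if allEq b u then ⟦ T (a ∷ u) ∧ not (T (b ∷ replicate n a)) ⟧ else 0))
        ≡⟨ sum-cong-≗ (λ b → trans (∑ᵛ-if0 n (eqb a b) (λ u → if allEq b u then ⟦ T (a ∷ u) ∧ not (T (b ∷ replicate n a)) ⟧ else 0)) (cong (λ z → if eqb a b then 0 else z) (∑ᵛ-pick n b (λ u → ⟦ T (a ∷ u) ∧ not (T (b ∷ replicate n a)) ⟧)))) ⟩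
      ∑[ b < m ] (if eqb a b then 0 else ⟦ x a b ∧ not (x b a) ⟧)
        ≡⟨ sum-cong-≗ drop-diagonal ⟩
      ∑[ b < m ] ⟦ x a b ∧ not (x b a) ⟧ ∎
      where
      cornerTerm : ∀ u b → ∑ᵛ n (λ v → B a u b v) ≡ (if eqb a b then 0 else (if allEq b u then ⟦ T (a ∷ u) ∧ not (T (b ∷ replicate n a)) ⟧ else 0))
      cornerTerm u b with eqb a b
      ... | true = ∑ᵛ-zero n
      ... | false with allEq b u
      ...   | true = ∑ᵛ-pick n a (λ v → ⟦ T (a ∷ u) ∧ not (T (b ∷ v)) ⟧)
      ...   | false = ∑ᵛ-zero n
      drop-diagonal : ∀ b → (if eqb a b then 0 else ⟦ x a b ∧ not (x b a) ⟧) ≡ ⟦ x a b ∧ not (x b a) ⟧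
      drop-diagonal b with eqb a b in e
      ... | true rewrite eqb-true a b e = sym (cong ⟦_⟧ (∧-inverseʳ (x b b)))
      ... | false = refl

  φ-single : ∀ b → φ 0 ⟦ b ⟧ (∑[ _ < m ] ⟦ b ⟧) ≡ 0
  φ-single true = trans (cong (m ∸_) (trans (∑-const m 1) (*-identityʳ m))) (n∸n≡0 m)
  φ-single false = sum-replicate-zero m

  φ≤innerᵛ : ∀ n (T : VSubset n m) → φ n (cardᵛ T) (cornerCount T) ≤ innerᵛ T
  φ≤innerᵛ zero T = ≤-trans (≤-reflexive (φ-single (T []))) z≤n
  φ≤innerᵛ (suc n) T = begin
    φ (suc n) (∑[ a < m ] cardᵛ {n} (λ w → T (a ∷ w))) (∑[ a < m ] ⟦ x a a ⟧)
      ≤⟨ φ-step-bound n (λ a → cardᵛ {n} (λ w → T (a ∷ w))) x (λ a → ∑ᵛ⟦⟧≤ n (λ w → T (a ∷ w))) ⟩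
    ∑[ a < m ] φ n (cardᵛ {n} (λ w → T (a ∷ w))) (cornerCount {n} (λ w → T (a ∷ w))) + bridgeCut x
      ≤⟨ +-monoˡ-≤ (bridgeCut x) (∑-mono-≤ m (λ a → φ≤innerᵛ n (λ w → T (a ∷ w)))) ⟩
    ∑[ a < m ] innerᵛ {n} (λ w → T (a ∷ w)) + bridgeCut x
      ≡⟨ sym (innerᵛ-decomposition n T) ⟩
    innerᵛ T ∎
    where
    open ≤-Reasoning
    x : Fin m → Fin m → Bool
    x a b = T (a ∷ replicate n b)

  lex : ∀ n → ℕ → VSubset n m
  lex n ℓ = Lex⁻¹ n m ℓ

  lexVal<m^n : ∀ n (v : Vx n) → lexVal v < m ^ n
  lexVal<m^n zero [] = s≤s z≤n
  lexVal<m^n (suc n) (a ∷ v) = begin-strict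
    toℕ a * m ^ n + lexVal v <⟨ +-monoʳ-< (toℕ a * m ^ n) (lexVal<m^n n v) ⟩
    toℕ a * m ^ n + m ^ n ≤⟨ +-monoˡ-≤ (m ^ n) (*-monoˡ-≤ (m ^ n) (≤-pred (toℕ<n a))) ⟩
    m₀ * m ^ n + m ^ n ≡⟨ +-comm (m₀ * m ^ n) (m ^ n) ⟩
    m ^ suc n ∎
    where open ≤-Reasoning

  lex-slice : ∀ n ℓ q r (a : Fin m) (u : Vx n) → ℓ ≡ q * m ^ n + r → r ≤ m ^ n →
    lex (suc n) ℓ (a ∷ u) ≡ ((toℕ a <ᵇ q) ∨ ((toℕ a ≡ᵇ q) ∧ lex n r u))
  lex-slice n ℓ q r a u refl r≤M with <-cmp (toℕ a) q
  ... | tri< h _ _ rewrite <ᵇ-true h = ≤ᵇ-true (begin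
        suc (toℕ a * m ^ n + lexVal u) ≡⟨ sym (+-suc (toℕ a * m ^ n) (lexVal u)) ⟩
        toℕ a * m ^ n + suc (lexVal u) ≤⟨ +-monoʳ-≤ (toℕ a * m ^ n) (lexVal<m^n n u) ⟩
        toℕ a * m ^ n + m ^ n ≡⟨ +-comm (toℕ a * m ^ n) (m ^ n) ⟩
        suc (toℕ a) * m ^ n ≤⟨ *-monoˡ-≤ (m ^ n) h ⟩
        q * m ^ n ≤⟨ m≤m+n (q * m ^ n) r ⟩
        q * m ^ n + r ∎)
    where open ≤-Reasoning
  ... | tri≈ _ refl _ rewrite <ᵇ-false (≤-refl {toℕ a}) | ≡ᵇ-refl (toℕ a) = ≤ᵇ-iff
    where
    ≤ᵇ-iff : (suc (toℕ a * m ^ n + lexVal u) ≤ᵇ toℕ a * m ^ n + r) ≡ (suc (lexVal u) ≤ᵇ r)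
    ≤ᵇ-iff with suc (lexVal u) ≤ᵇ r in e
    ... | true = ≤ᵇ-true (≤-trans (≤-reflexive (sym (+-suc _ _))) (+-monoʳ-≤ (toℕ a * m ^ n) (≤ᵇ⇒≤ _ r (subst T (sym e) tt))))
    ... | false = ≤ᵇ-false (s≤s (+-monoʳ-≤ (toℕ a * m ^ n) (≤-pred (≰⇒> (λ h → subst T e (≤⇒≤ᵇ h))))))
  ... | tri> _ _ h rewrite <ᵇ-false (<⇒≤ h) | ≡ᵇ-false (λ (e : toℕ a ≡ q) → <⇒≢ h (sym e)) = ≤ᵇ-false (begin-strict
        q * m ^ n + r ≤⟨ +-monoʳ-≤ (q * m ^ n) r≤M ⟩
        q * m ^ n + m ^ n ≡⟨ +-comm (q * m ^ n) (m ^ n) ⟩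
        suc q * m ^ n ≤⟨ *-monoˡ-≤ (m ^ n) h ⟩
        toℕ a * m ^ n ≤⟨ m≤m+n (toℕ a * m ^ n) (lexVal u) ⟩
        toℕ a * m ^ n + lexVal u <⟨ ≤-refl ⟩
        suc (toℕ a * m ^ n + lexVal u) ∎)
    where open ≤-Reasoning

  card-lex-step : ∀ n ℓ q r → ℓ ≡ q * m ^ n + r → q < m → r ≤ m ^ n → cardᵛ (lex n r) ≡ r → cardᵛ (lex (suc n) ℓ) ≡ ℓ
  card-lex-step n ℓ q r e q<m r≤M ih = begin
    ∑[ a < m ] ∑ᵛ n (λ u → ⟦ lex (suc n) ℓ (a ∷ u) ⟧)
      ≡⟨ sum-cong-≗ (λ a → trans (∑ᵛ-cong n (λ u → cong ⟦_⟧ (lex-slice n ℓ q r a u e r≤M))) (pointwise a)) ⟩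
    ∑[ a < m ] (⟦ toℕ a <ᵇ q ⟧ * m ^ n + ⟦ toℕ a ≡ᵇ q ⟧ * r)
      ≡⟨ ∑-distrib-+ {m} (λ a → ⟦ toℕ a <ᵇ q ⟧ * m ^ n) (λ a → ⟦ toℕ a ≡ᵇ q ⟧ * r) ⟩
    ∑[ a < m ] (⟦ toℕ a <ᵇ q ⟧ * m ^ n) + ∑[ a < m ] (⟦ toℕ a ≡ᵇ q ⟧ * r)
      ≡⟨ cong₂ _+_ (trans (sum-cong-≗ {m} (λ a → *-comm ⟦ toℕ a <ᵇ q ⟧ (m ^ n))) (trans (sym (*-distribˡ-sum {m} (m ^ n) (λ a → ⟦ toℕ a <ᵇ q ⟧))) (trans (cong (m ^ n *_) (∑-count< m q (<⇒≤ q<m))) (*-comm (m ^ n) q))))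
                   (trans (sum-cong-≗ {m} (λ a → *-comm ⟦ toℕ a ≡ᵇ q ⟧ r)) (trans (sym (*-distribˡ-sum {m} r (λ a → ⟦ toℕ a ≡ᵇ q ⟧))) (trans (cong (r *_) (∑-count≡ m q q<m)) (*-identityʳ r)))) ⟩
    q * m ^ n + r
      ≡⟨ sym e ⟩
    ℓ ∎
    where
    open ≡-Reasoning
    pointwise : ∀ a → ∑ᵛ n (λ u → ⟦ (toℕ a <ᵇ q) ∨ ((toℕ a ≡ᵇ q) ∧ lex n r u) ⟧) ≡ ⟦ toℕ a <ᵇ q ⟧ * m ^ n + ⟦ toℕ a ≡ᵇ q ⟧ * r
    pointwise a with <-cmp (toℕ a) q
    ... | tri< h _ _ rewrite <ᵇ-true h | ≡ᵇ-false (<⇒≢ h) = trans (∑ᵛ-const n 1) (trans (*-identityʳ (m ^ n)) (sym (trans (+-identityʳ (m ^ n + 0)) (+-identityʳ (m ^ n)))))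
    ... | tri≈ _ e' _ rewrite <ᵇ-false (≤-reflexive (sym e')) | trans (cong (toℕ a ≡ᵇ_) (sym e')) (≡ᵇ-refl (toℕ a)) = trans ih (sym (+-identityʳ r))
    ... | tri> _ _ h rewrite <ᵇ-false (<⇒≤ h) | ≡ᵇ-false (λ (e' : toℕ a ≡ q) → <⇒≢ h (sym e')) = ∑ᵛ-zero n

  card-lex : ∀ n ℓ → ℓ ≤ m ^ n → cardᵛ (lex n ℓ) ≡ ℓ
  card-lex zero zero h = refl
  card-lex zero (suc zero) h = refl
  card-lex zero (suc (suc ℓ)) (s≤s ())
  card-lex (suc n) ℓ h with digits-bounds n ℓ h
  ... | q<m , r≤M , e = card-lex-step n ℓ (fullBlocks n ℓ) (partBlock n ℓ) e q<m r≤M (card-lex n (partBlock n ℓ) r≤M)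

  lex-slice-corner : ∀ B q c → ((B <ᵇ q) ∨ ((B ≡ᵇ q) ∧ (B <ᵇ c))) ≡ (B <ᵇ κ q c)
  lex-slice-corner B q c with <-cmp B q
  ... | tri< h _ _ rewrite <ᵇ-true h = sym (<ᵇ-true (≤-trans h (q≤κ q c)))
  ... | tri≈ _ refl _ rewrite <ᵇ-false (≤-refl {B}) | ≡ᵇ-refl B with ≤-<-connex c B
  ...   | inj₁ cB rewrite κ≡q B c cB = trans (<ᵇ-false cB) (sym (<ᵇ-false (≤-refl {B})))
  ...   | inj₂ Bc rewrite κ≡suc-q B c Bc = trans (<ᵇ-true Bc) (sym (<ᵇ-true (≤-refl {suc B})))
  lex-slice-corner B q c | tri> _ _ h rewrite <ᵇ-false (<⇒≤ h) | ≡ᵇ-false (λ (e' : B ≡ q) → <⇒≢ h (sym e')) = sym (<ᵇ-false (≤-trans (κ≤s q c) h))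
    where
    κ≤s : ∀ q c → κ q c ≤ suc q
    κ≤s q c with ≤-<-connex c q
    ... | inj₁ x = ≤-trans (≤-reflexive (κ≡q q c x)) (n≤1+n q)
    ... | inj₂ x = ≤-reflexive (κ≡suc-q q c x)

  lex-corner : ∀ n ℓ (b : Fin m) → ℓ ≤ m ^ n → lex n ℓ (replicate n b) ≡ (toℕ b <ᵇ lexCorners n ℓ)
  lex-corner zero zero b h = refl
  lex-corner zero (suc zero) b h = sym (<ᵇ-true (toℕ<n b))
  lex-corner zero (suc (suc ℓ)) b (s≤s ())
  lex-corner (suc n) ℓ b h with digits-bounds n ℓ h
  ... | q<m , r≤M , e =
    trans (lex-slice n ℓ (fullBlocks n ℓ) (partBlock n ℓ) b (replicate n b) e r≤M)
      (trans (cong (λ z → (toℕ b <ᵇ fullBlocks n ℓ) ∨ ((toℕ b ≡ᵇ fullBlocks n ℓ) ∧ z)) (lex-corner n (partBlock n ℓ) b r≤M))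
        (lex-slice-corner (toℕ b) (fullBlocks n ℓ) (lexCorners n (partBlock n ℓ))))

  -- inLex A B says that the corner Bⁿ of copy A is in a lexicographic set with q full copies
  -- followed by a partial copy with c corners.
  module LexBridges (q c : ℕ) (q<m : q < m) (c≤m : c ≤ m) where

    inLex : ℕ → ℕ → Bool
    inLex A B = (A <ᵇ q) ∨ ((A ≡ᵇ q) ∧ (B <ᵇ c))

    blocksAbove cornersAbove : ℕ
    blocksAbove = m ∸ suc q
    cornersAbove = c ∸ suc q

    pad : ∀ a b → a + b ≡ a + 0 + b + 0
    pad = solve-∀

    ⟦not-inLex⟧ : ∀ A B → ⟦ not (inLex B A) ⟧ ≡ ⟦ q <ᵇ B ⟧ + ⟦ B ≡ᵇ q ⟧ * ⟦ not (A <ᵇ c) ⟧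
    ⟦not-inLex⟧ A B with <-cmp B q
    ... | tri< h _ _ rewrite <ᵇ-true h | ≡ᵇ-false (<⇒≢ h) | <ᵇ-false (<⇒≤ h) = refl
    ... | tri≈ _ e _ rewrite <ᵇ-false (≤-reflexive (sym e)) | trans (cong (B ≡ᵇ_) (sym e)) (≡ᵇ-refl B) | <ᵇ-false (≤-reflexive e) = sym (+-identityʳ _)
    ... | tri> _ _ h rewrite <ᵇ-false (<⇒≤ h) | ≡ᵇ-false (λ (e' : B ≡ q) → <⇒≢ h (sym e')) | <ᵇ-true h = refl

    row-at-q : ∀ A B → A ≡ q → ⟦ (B <ᵇ c) ∧ not (inLex B A) ⟧ ≡ ⟦ not (B <ᵇ suc q) ∧ (B <ᵇ c) ⟧
    row-at-q A B eA with <-cmp B q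
    ... | tri< h _ _ rewrite <ᵇ-true h | <ᵇ-true (≤-trans h (n≤1+n q)) = cong ⟦_⟧ (∧-zeroʳ (B <ᵇ c))
    ... | tri≈ _ e _ rewrite <ᵇ-false (≤-reflexive (sym e)) | trans (cong (B ≡ᵇ_) (sym e)) (≡ᵇ-refl B) | <ᵇ-true (s≤s (≤-reflexive e)) | trans eA (sym e) = cong ⟦_⟧ (∧-inverseʳ (B <ᵇ c))
    ... | tri> _ _ h rewrite <ᵇ-false (<⇒≤ h) | ≡ᵇ-false (λ (e' : B ≡ q) → <⇒≢ h (sym e')) | <ᵇ-false h = cong ⟦_⟧ (∧-identityʳ (B <ᵇ c))

    row-count : ∀ (a : Fin m) → ∑[ b < m ] ⟦ inLex (toℕ a) (toℕ b) ∧ not (inLex (toℕ b) (toℕ a)) ⟧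
          ≡ ⟦ toℕ a <ᵇ q ⟧ * blocksAbove + ⟦ not (toℕ a <ᵇ c) ∧ (toℕ a <ᵇ q) ⟧ + ⟦ toℕ a ≡ᵇ q ⟧ * cornersAbove
    row-count a with <-cmp (toℕ a) q
    ... | tri< h _ _ rewrite <ᵇ-true h | ≡ᵇ-false (<⇒≢ h) | ∧-identityʳ (not (toℕ a <ᵇ c)) =
      trans (sum-cong-≗ {m} (λ b → ⟦not-inLex⟧ (toℕ a) (toℕ b)))
        (trans (∑-distrib-+ {m} (λ b → ⟦ q <ᵇ toℕ b ⟧) (λ b → ⟦ toℕ b ≡ᵇ q ⟧ * ⟦ not (toℕ a <ᵇ c) ⟧))
          (trans (cong₂ _+_ (∑-count> m q q<m)
            (trans (sum-cong-≗ {m} (λ b → *-comm ⟦ toℕ b ≡ᵇ q ⟧ ⟦ not (toℕ a <ᵇ c) ⟧))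
              (trans (sym (*-distribˡ-sum {m} ⟦ not (toℕ a <ᵇ c) ⟧ (λ b → ⟦ toℕ b ≡ᵇ q ⟧)))
                (trans (cong (⟦ not (toℕ a <ᵇ c) ⟧ *_) (∑-count≡ m q q<m)) (*-identityʳ _)))))
            (pad blocksAbove ⟦ not (toℕ a <ᵇ c) ⟧)))
    ... | tri≈ _ e _ rewrite <ᵇ-false (≤-reflexive (sym e)) | trans (cong (toℕ a ≡ᵇ_) (sym e)) (≡ᵇ-refl (toℕ a)) | ∧-zeroʳ (not (toℕ a <ᵇ c)) =
      trans (sum-cong-≗ {m} (λ b → row-at-q (toℕ a) (toℕ b) e)) (trans (∑-count-between m (suc q) c c≤m) (sym (+-identityʳ cornersAbove)))
    ... | tri> _ _ h rewrite <ᵇ-false (<⇒≤ h) | ≡ᵇ-false (λ (e' : toℕ a ≡ q) → <⇒≢ h (sym e')) | ∧-zeroʳ (not (toℕ a <ᵇ c)) = sum-replicate-zero m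

    bridges-count : ∑[ a < m ] ∑[ b < m ] ⟦ inLex (toℕ a) (toℕ b) ∧ not (inLex (toℕ b) (toℕ a)) ⟧ ≡ blockPairs m q + ∣ κ q c - c ∣
    bridges-count = begin
      ∑[ a < m ] ∑[ b < m ] ⟦ inLex (toℕ a) (toℕ b) ∧ not (inLex (toℕ b) (toℕ a)) ⟧
        ≡⟨ sum-cong-≗ {m} row-count ⟩
      ∑[ a < m ] (⟦ toℕ a <ᵇ q ⟧ * blocksAbove + ⟦ not (toℕ a <ᵇ c) ∧ (toℕ a <ᵇ q) ⟧ + ⟦ toℕ a ≡ᵇ q ⟧ * cornersAbove)
        ≡⟨ trans (∑-distrib-+ {m} (λ a → ⟦ toℕ a <ᵇ q ⟧ * blocksAbove + ⟦ not (toℕ a <ᵇ c) ∧ (toℕ a <ᵇ q) ⟧) (λ a → ⟦ toℕ a ≡ᵇ q ⟧ * cornersAbove))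
                 (cong (_+ ∑[ a < m ] (⟦ toℕ a ≡ᵇ q ⟧ * cornersAbove)) (∑-distrib-+ {m} (λ a → ⟦ toℕ a <ᵇ q ⟧ * blocksAbove) (λ a → ⟦ not (toℕ a <ᵇ c) ∧ (toℕ a <ᵇ q) ⟧))) ⟩
      ∑[ a < m ] (⟦ toℕ a <ᵇ q ⟧ * blocksAbove) + ∑[ a < m ] ⟦ not (toℕ a <ᵇ c) ∧ (toℕ a <ᵇ q) ⟧ + ∑[ a < m ] (⟦ toℕ a ≡ᵇ q ⟧ * cornersAbove)
        ≡⟨ cong₂ (λ x y → x + ∑[ a < m ] ⟦ not (toℕ a <ᵇ c) ∧ (toℕ a <ᵇ q) ⟧ + y)
             (trans (sum-cong-≗ {m} (λ a → *-comm ⟦ toℕ a <ᵇ q ⟧ blocksAbove)) (trans (sym (*-distribˡ-sum {m} blocksAbove (λ a → ⟦ toℕ a <ᵇ q ⟧))) (trans (cong (blocksAbove *_) (∑-count< m q (<⇒≤ q<m))) (*-comm blocksAbove q))))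
             (trans (sum-cong-≗ {m} (λ a → *-comm ⟦ toℕ a ≡ᵇ q ⟧ cornersAbove)) (trans (sym (*-distribˡ-sum {m} cornersAbove (λ a → ⟦ toℕ a ≡ᵇ q ⟧))) (trans (cong (cornersAbove *_) (∑-count≡ m q q<m)) (*-identityʳ cornersAbove)))) ⟩
      q * blocksAbove + ∑[ a < m ] ⟦ not (toℕ a <ᵇ c) ∧ (toℕ a <ᵇ q) ⟧ + cornersAbove
        ≡⟨ cong (λ z → q * blocksAbove + z + cornersAbove) (∑-count-between m c q (<⇒≤ q<m)) ⟩
      q * blocksAbove + (q ∸ c) + cornersAbove
        ≡⟨ +-assoc (q * blocksAbove) (q ∸ c) cornersAbove ⟩
      q * blocksAbove + ((q ∸ c) + cornersAbove)
        ≡⟨ cong (q * blocksAbove +_) (sym (∣κ-∣-split q c)) ⟩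
      blockPairs m q + ∣ κ q c - c ∣ ∎
      where open ≡-Reasoning

  innerᵛ-cong : ∀ n {S S' : VSubset n m} → (∀ w → S w ≡ S' w) → innerᵛ S ≡ innerᵛ S'
  innerᵛ-cong n e = ∑ᵛ-cong n (λ u → ∑ᵛ-cong n (λ v → cong₂ (λ x y → ⟦ x ∧ (not y ∧ adj u v) ⟧) (e u) (e v)))

  innerᵛ-const : ∀ n (b : Bool) → innerᵛ {n} (λ _ → b) ≡ 0
  innerᵛ-const n b = trans (∑ᵛ-cong n (λ u → trans (∑ᵛ-cong n (λ v → z b (adj u v))) (∑ᵛ-zero n))) (∑ᵛ-zero n)
    where
    z : ∀ b x → ⟦ b ∧ (not b ∧ x) ⟧ ≡ 0
    z true x = refl
    z false x = refl

  ⟦b∧¬b∧false⟧≡0 : ∀ b → ⟦ b ∧ (not b ∧ false) ⟧ ≡ 0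
  ⟦b∧¬b∧false⟧≡0 true = refl
  ⟦b∧¬b∧false⟧≡0 false = refl

  innerᵛ-lex≤φ : ∀ n ℓ → ℓ ≤ m ^ n → innerᵛ (lex n ℓ) ≤ φ n ℓ (lexCorners n ℓ)
  innerᵛ-lex≤φ zero ℓ h = ≤-trans (≤-reflexive (⟦b∧¬b∧false⟧≡0 (lex 0 ℓ []))) z≤n
  innerᵛ-lex≤φ (suc n) ℓ h with digits-bounds n ℓ h
  ... | q<m , r≤M , e = begin
    innerᵛ (lex (suc n) ℓ)
      ≡⟨ innerᵛ-decomposition n (lex (suc n) ℓ) ⟩
    ∑[ a < m ] innerᵛ {n} (λ w → lex (suc n) ℓ (a ∷ w)) + bridgeCut x
      ≡⟨ cong₂ _+_ ∑-innerᵛ-slices bridgeCut-lex ⟩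
    innerᵛ (lex n r) + (blockPairs m q + ∣ κ q c - c ∣)
      ≤⟨ +-monoˡ-≤ _ (innerᵛ-lex≤φ n r r≤M) ⟩
    φ n r c + (blockPairs m q + ∣ C' - c ∣)
      ≡⟨ x∙yz≈y∙xz (φ n r c) (blockPairs m q) ∣ C' - c ∣ ⟩
    blockPairs m q + (φ n r c + ∣ C' - c ∣)
      ≤⟨ +-monoʳ-≤ (blockPairs m q) (φ-V n r C' r≤M (κ≤m m q c q<m)) ⟩
    blockPairs m q + φ n r C'
      ≡⟨ sym (trans (cong₂ (λ z w → blockPairs m q + z + φ n r w) (trans (cong (λ w → ∣ w - C' ∣) (κ-idem q c)) (∣n-n∣≡0 C')) (κ-idem q c)) (cong (_+ φ n r C') (+-identityʳ (blockPairs m q)))) ⟩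
    ψ m q C' + φ n r (κ q C') ∎
    where
    open ≤-Reasoning
    q = fullBlocks n ℓ
    r = partBlock n ℓ
    c = lexCorners n r
    C' = κ q c
    x : Fin m → Fin m → Bool
    x a b = lex (suc n) ℓ (a ∷ replicate n b)
    innerᵛ-slice : ∀ a → innerᵛ {n} (λ w → lex (suc n) ℓ (a ∷ w)) ≡ ⟦ toℕ a ≡ᵇ q ⟧ * innerᵛ (lex n r)
    innerᵛ-slice a with <-cmp (toℕ a) q
    ... | tri< hh _ _ = trans (innerᵛ-cong n (λ w → trans (lex-slice n ℓ q r a w e r≤M) (cong (λ z → z ∨ ((toℕ a ≡ᵇ q) ∧ lex n r w)) (<ᵇ-true hh))))
                     (trans (innerᵛ-const n true) (cong (_* innerᵛ (lex n r)) (cong ⟦_⟧ (sym (≡ᵇ-false (<⇒≢ hh))))))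
    ... | tri≈ _ e' _ = trans (innerᵛ-cong n (λ w → trans (lex-slice n ℓ q r a w e r≤M) (cong₂ (λ z y → z ∨ (y ∧ lex n r w)) (<ᵇ-false (≤-reflexive (sym e'))) (trans (cong (toℕ a ≡ᵇ_) (sym e')) (≡ᵇ-refl (toℕ a))))))
                     (trans (sym (+-identityʳ _)) (cong (_* innerᵛ (lex n r)) (cong ⟦_⟧ (sym (trans (cong (toℕ a ≡ᵇ_) (sym e')) (≡ᵇ-refl (toℕ a)))))))
    ... | tri> _ _ hh = trans (innerᵛ-cong n (λ w → trans (lex-slice n ℓ q r a w e r≤M) (cong₂ (λ z y → z ∨ (y ∧ lex n r w)) (<ᵇ-false (<⇒≤ hh)) (≡ᵇ-false (λ (e' : toℕ a ≡ q) → <⇒≢ hh (sym e'))))))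
                     (trans (innerᵛ-const n false) (cong (_* innerᵛ (lex n r)) (cong ⟦_⟧ (sym (≡ᵇ-false (λ (e' : toℕ a ≡ q) → <⇒≢ hh (sym e')))))))
    ∑-innerᵛ-slices : ∑[ a < m ] innerᵛ {n} (λ w → lex (suc n) ℓ (a ∷ w)) ≡ innerᵛ (lex n r)
    ∑-innerᵛ-slices = trans (sum-cong-≗ {m} (λ a → trans (innerᵛ-slice a) (*-comm ⟦ toℕ a ≡ᵇ q ⟧ (innerᵛ (lex n r)))))
                 (trans (sym (*-distribˡ-sum {m} (innerᵛ (lex n r)) (λ a → ⟦ toℕ a ≡ᵇ q ⟧))) (trans (cong (innerᵛ (lex n r) *_) (∑-count≡ m q q<m)) (*-identityʳ _)))
    corner-in-lex : ∀ a b → x a b ≡ LexBridges.inLex q c q<m (lexCorners≤m n r) (toℕ a) (toℕ b)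
    corner-in-lex a b = trans (lex-slice n ℓ q r a (replicate n b) e r≤M) (cong (λ z → (toℕ a <ᵇ q) ∨ ((toℕ a ≡ᵇ q) ∧ z)) (lex-corner n r b r≤M))
    bridgeCut-lex : bridgeCut x ≡ blockPairs m q + ∣ κ q c - c ∣
    bridgeCut-lex = trans (sum-cong-≗ {m} (λ a → sum-cong-≗ {m} (λ b → cong₂ (λ y z → ⟦ y ∧ not z ⟧) (corner-in-lex a b) (corner-in-lex b a))))
                    (LexBridges.bridges-count q c q<m (lexCorners≤m n r))

  ⟦∨⟧-disjoint : ∀ α γ β δ → (α ∧ γ) ≡ false → ⟦ (α ∧ β) ∨ (γ ∧ δ) ⟧ ≡ ⟦ α ∧ β ⟧ + ⟦ γ ∧ δ ⟧
  ⟦∨⟧-disjoint true true β δ ()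
  ⟦∨⟧-disjoint true false true δ _ = refl
  ⟦∨⟧-disjoint true false false δ _ = refl
  ⟦∨⟧-disjoint false γ β δ _ = refl

  ≤ᵇ≡not<ᵇ : ∀ x y → (x ≤ᵇ y) ≡ not (y <ᵇ x)
  ≤ᵇ≡not<ᵇ x y with ≤-<-connex x y
  ... | inj₁ h rewrite ≤ᵇ-true h | <ᵇ-false h = refl
  ... | inj₂ h rewrite ≤ᵇ-false h | <ᵇ-true h = refl

  below∧above≡false : ∀ s t A → ((A <ᵇ s) ∧ ((s + t) ≤ᵇ A)) ≡ false
  below∧above≡false s t A with ≤-<-connex s A
  ... | inj₁ h rewrite <ᵇ-false h = refl
  ... | inj₂ h rewrite <ᵇ-true h = ≤ᵇ-false (≤-trans h (m≤m+n s t))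

  ⟦⟧-split₃ : ∀ α γ y → (α ∧ γ) ≡ false → ⟦ y ⟧ ≡ ⟦ α ∧ y ⟧ + ⟦ not α ∧ (not γ ∧ y) ⟧ + ⟦ γ ∧ y ⟧
  ⟦⟧-split₃ true true y ()
  ⟦⟧-split₃ true false true _ = refl
  ⟦⟧-split₃ true false false _ = refl
  ⟦⟧-split₃ false true true _ = refl
  ⟦⟧-split₃ false true false _ = refl
  ⟦⟧-split₃ false false true _ = refl
  ⟦⟧-split₃ false false false _ = refl

  ⟦⟧-split₂ : ∀ α y → ⟦ α ∧ not y ⟧ + ⟦ α ∧ y ⟧ ≡ ⟦ α ⟧
  ⟦⟧-split₂ true true = refl
  ⟦⟧-split₂ true false = refl
  ⟦⟧-split₂ false y = refl

  ⟦middle⟧≤ : ∀ α β y → ⟦ not α ∧ (not (not β) ∧ y) ⟧ ≤ ⟦ not α ∧ β ⟧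
  ⟦middle⟧≤ true β y = z≤n
  ⟦middle⟧≤ false true y = ⟦⟧≤1 y
  ⟦middle⟧≤ false false y = z≤n

  exteriorCut-lex≤ : ∀ s t c (y : Fin m → Bool) → s + t ≤ m → c ≤ m →
    ∑[ i < m ] ⟦ ((toℕ i <ᵇ s) ∧ not (toℕ i <ᵇ c)) ∨ (((s + t) ≤ᵇ toℕ i) ∧ (toℕ i <ᵇ c)) ⟧
    ≤ ∑[ i < m ] ⟦ ((toℕ i <ᵇ s) ∧ not (y i)) ∨ (((s + t) ≤ᵇ toℕ i) ∧ y i) ⟧ + ∣ ∑[ i < m ] ⟦ y i ⟧ - c ∣
  exteriorCut-lex≤ s t c y stm c≤m = begin
    ∑[ i < m ] ⟦ (α i ∧ not (toℕ i <ᵇ c)) ∨ (γ i ∧ (toℕ i <ᵇ c)) ⟧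
      ≡⟨ trans (sum-cong-≗ (λ i → ⟦∨⟧-disjoint (α i) (γ i) (not (toℕ i <ᵇ c)) (toℕ i <ᵇ c) (below∧above≡false s t (toℕ i)))) (∑-distrib-+ (λ i → ⟦ α i ∧ not (toℕ i <ᵇ c) ⟧) (λ i → ⟦ γ i ∧ (toℕ i <ᵇ c) ⟧)) ⟩
    ∑[ i < m ] ⟦ α i ∧ not (toℕ i <ᵇ c) ⟧ + ∑[ i < m ] ⟦ γ i ∧ (toℕ i <ᵇ c) ⟧
      ≡⟨ cong₂ _+_ (trans (sum-cong-≗ (λ i → cong ⟦_⟧ (∧-comm (α i) (not (toℕ i <ᵇ c))))) (∑-count-between m c s (≤-trans (m≤m+n s t) stm)))
                   (trans (sum-cong-≗ {m} (λ i → cong (λ z → ⟦ z ∧ (toℕ i <ᵇ c) ⟧) (≤ᵇ≡not<ᵇ (s + t) (toℕ i)))) (∑-count-between m (s + t) c c≤m)) ⟩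
    (s ∸ c) + (c ∸ (s + t))
      ≤⟨ exterior-arith s t c eS kI kJ kK eSkI kJt ⟩
    eS + kK + ∣ kI + kJ + kK - c ∣
      ≡⟨ cong₂ (λ a b → a + ∣ b - c ∣) (sym (trans (sum-cong-≗ (λ i → ⟦∨⟧-disjoint (α i) (γ i) (not (y i)) (y i) (below∧above≡false s t (toℕ i)))) (∑-distrib-+ (λ i → ⟦ α i ∧ not (y i) ⟧) (λ i → ⟦ γ i ∧ y i ⟧)))) (sym ksplit) ⟩
    ∑[ i < m ] ⟦ (α i ∧ not (y i)) ∨ (γ i ∧ y i) ⟧ + ∣ ∑[ i < m ] ⟦ y i ⟧ - c ∣ ∎
    where
    open ≤-Reasoning
    α γ : Fin m → Bool
    α i = toℕ i <ᵇ s
    γ i = (s + t) ≤ᵇ toℕ i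
    eS kI kJ kK : ℕ
    eS = ∑[ i < m ] ⟦ α i ∧ not (y i) ⟧
    kI = ∑[ i < m ] ⟦ α i ∧ y i ⟧
    kJ = ∑[ i < m ] ⟦ not (α i) ∧ (not (γ i) ∧ y i) ⟧
    kK = ∑[ i < m ] ⟦ γ i ∧ y i ⟧
    eSkI : eS + kI ≡ s
    eSkI = trans (sym (∑-distrib-+ (λ i → ⟦ α i ∧ not (y i) ⟧) (λ i → ⟦ α i ∧ y i ⟧))) (trans (sum-cong-≗ (λ i → ⟦⟧-split₂ (α i) (y i))) (∑-count< m s (≤-trans (m≤m+n s t) stm)))
    kJt : kJ ≤ t
    kJt = ≤-trans (∑-mono-≤ m (λ i → ≤-trans (≤-reflexive (cong (λ z → ⟦ not (α i) ∧ (not z ∧ y i) ⟧) (≤ᵇ≡not<ᵇ (s + t) (toℕ i))))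
                                                  (⟦middle⟧≤ (α i) (toℕ i <ᵇ s + t) (y i))))
                  (≤-reflexive (trans (∑-count-between m s (s + t) stm) (m+n∸m≡n s t)))
    ksplit : ∑[ i < m ] ⟦ y i ⟧ ≡ kI + kJ + kK
    ksplit = trans (sum-cong-≗ (λ i → ⟦⟧-split₃ (α i) (γ i) (y i) (below∧above≡false s t (toℕ i))))
                   (trans (∑-distrib-+ (λ i → ⟦ α i ∧ y i ⟧ + ⟦ not (α i) ∧ (not (γ i) ∧ y i) ⟧) (λ i → ⟦ γ i ∧ y i ⟧))
                          (cong (_+ kK) (∑-distrib-+ (λ i → ⟦ α i ∧ y i ⟧) (λ i → ⟦ not (α i) ∧ (not (γ i) ∧ y i) ⟧))))

  lex-minimises-Θ : ∀ n ℓ s t → s + t ≤ m → ℓ ≤ m ^ n → (S : VSubset n m) → card S ≡ ℓ →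
    Θ-size s t (lex n ℓ) ≤ Θ-size s t S
  lex-minimises-Θ n ℓ s t s+t≤m ℓ≤mⁿ S card≡ℓ = begin
    innerCut (lex n ℓ) + exteriorCut s t (lex n ℓ)
      ≡⟨ cong₂ _+_ (innerCut≡innerᵛ n (lex n ℓ)) (trans (exteriorCut≡∑ s t n (lex n ℓ)) (sum-cong-≗ (λ i → cong (λ z → ⟦ ((toℕ i <ᵇ s) ∧ not z) ∨ (((s + t) ≤ᵇ toℕ i) ∧ z) ⟧) (lex-corner n ℓ i ℓ≤mⁿ)))) ⟩
    innerᵛ (lex n ℓ) + ∑[ i < m ] ⟦ ((toℕ i <ᵇ s) ∧ not (toℕ i <ᵇ c)) ∨ (((s + t) ≤ᵇ toℕ i) ∧ (toℕ i <ᵇ c)) ⟧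
      ≤⟨ +-mono-≤ (innerᵛ-lex≤φ n ℓ ℓ≤mⁿ) (exteriorCut-lex≤ s t c y s+t≤m (lexCorners≤m n ℓ)) ⟩
    φ n ℓ c + (extS + ∣ K - c ∣)
      ≡⟨ x∙yz≈xz∙y (φ n ℓ c) extS ∣ K - c ∣ ⟩
    (φ n ℓ c + ∣ K - c ∣) + extS
      ≤⟨ +-monoˡ-≤ extS (φ-V n ℓ K ℓ≤mⁿ (∑⟦⟧≤ m y)) ⟩
    φ n ℓ K + extS
      ≤⟨ +-monoˡ-≤ extS (≤-trans (≤-reflexive (cong (λ z → φ n z K) (sym (trans (sym (card≡cardᵛ n S)) card≡ℓ)))) (φ≤innerᵛ n S)) ⟩
    innerᵛ S + extS
      ≡⟨ sym (cong₂ _+_ (innerCut≡innerᵛ n S) (exteriorCut≡∑ s t n S)) ⟩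
    innerCut S + exteriorCut s t S ∎
    where
    open ≤-Reasoning
    c = lexCorners n ℓ
    y : Fin m → Bool
    y i = S (corner n i)
    K = ∑[ i < m ] ⟦ y i ⟧
    extS = ∑[ i < m ] ⟦ ((toℕ i <ᵇ s) ∧ not (y i)) ∨ (((s + t) ≤ᵇ toℕ i) ∧ y i) ⟧

mainTheorem2 : (n m s t ℓ : ℕ) → 1 ≤ n → 2 ≤ m → s + t ≤ m → ℓ ≤ m ^ n →
    (card (Lex⁻¹ n m ℓ) ≡ ℓ)
    × ((S : VSubset n m) → card S ≡ ℓ → Θ-size s t (Lex⁻¹ n m ℓ) ≤ Θ-size s t S)
mainTheorem2 n (suc m₀) s t ℓ _ _ s+t≤m ℓ≤mⁿ =
  trans (card≡cardᵛ n (lex n ℓ)) (card-lex n ℓ ℓ≤mⁿ) , lex-minimises-Θ n ℓ s t s+t≤m ℓ≤mⁿ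
  where open SierpinskiCut m₀
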